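{- Let $\mathfrak{D}_n$ denote the set of desarrangements of length $n$, and define the exponential generating function \[ D^{\mathrm{des}}(t,x)=\sum_{n=0}^{\infty}\sum_{\pi\in\mathfrak{D}_n}t^{\mathrm{des}(\pi)}\frac{x^n}{n!}. \] Then \[ D^{\mathrm{des}}(t,x)=\frac{(1-t)(1-2t-e^{ -tx}+e^{(t-1)x})}{(1-2t)(e^{(t-1)x}-t)}. \]
   Context: Permutations $\pi\in\mathfrak{S}_n$ are written in one-line notation $\pi=\pi_1\pi_2\cdots\pi_n$; $\mathfrak{S}_0$ consists of the empty permutation. An index $i\in[n-1]$ is a descent of $\pi$ if $\pi_i>\pi_{i+1}$, and $\mathrm{des}(\pi)$ is the number of descents. An index $i\in[n]$ is an ascent of $\pi$ if it is not a descent (so $n$ is always an ascent). A permutation is a desarrangement if its first (smallest) ascent is even; the empty permutation is also considered a desarrangement. The identity is an identity of formal power series in $x$ with coefficients in $\mathbb{Q}(t)$. -}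

module Defs where

open import Data.Bool using (if_then_else_)
open import Data.Nat as ℕ using (ℕ; zero; suc; _∸_; _%_; _<ᵇ_)
open import Data.Nat.Combinatorics using (_C_)
open import Data.Integer using (ℤ; +_; _+_; _*_; -_; _-_)
open import Data.Fin using (Fin; toℕ)
open import Data.List using (List; []; _∷_; map; concatMap; filter; length; allFin)
open import Data.Vec using (Vec; []; _∷_; toList)
open import Data.Unit using (⊤; tt)
open import Data.Product using (_×_)
open import Relation.Nullary using (Dec; yes)
open import Relation.Nullary.Decidable using (_×-dec_)
open import Relation.Binary.PropositionalEquality using (_≡_)
import Data.List.Relation.Unary.Unique.DecPropositional as UniqueDec

open UniqueDec ℕ._≟_ using (Unique; unique?)

-- A word of length n over Fin n is listed as the list of its letters
-- (as natural numbers 0..n-1; shifting all values by one does not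
-- change descents).

oneLine : ∀ {n} → Vec (Fin n) n → List ℕ
oneLine v = map toℕ (toList v)

words : (m n : ℕ) → List (Vec (Fin m) n)
words m zero    = [] ∷ []
words m (suc n) = concatMap (λ i → map (i ∷_) (words m n)) (allFin m)

IsPermutation : List ℕ → Set
IsPermutation = Unique

des : List ℕ → ℕ
des (x ∷ y ∷ r) = (if y <ᵇ x then 1 else 0) ℕ.+ des (y ∷ r)
des _           = 0

-- first (smallest) ascent of a nonempty permutation (1-indexed);
-- index n is always an ascent
firstAscent : List ℕ → ℕ
firstAscent []          = 0
firstAscent (x ∷ [])    = 1
firstAscent (x ∷ y ∷ r) = if y <ᵇ x then suc (firstAscent (y ∷ r)) else 1

IsDesarrangement : List ℕ → Set
IsDesarrangement []      = ⊤
IsDesarrangement (x ∷ r) = firstAscent (x ∷ r) % 2 ≡ 0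

isDesarrangement? : (l : List ℕ) → Dec (IsDesarrangement l)
isDesarrangement? []      = yes tt
isDesarrangement? (x ∷ r) = (firstAscent (x ∷ r) % 2) ℕ.≟ 0

Counted : (n k : ℕ) → Vec (Fin n) n → Set
Counted n k v = IsPermutation (oneLine v) × IsDesarrangement (oneLine v) × des (oneLine v) ≡ k

counted? : (n k : ℕ) → (v : Vec (Fin n) n) → Dec (Counted n k v)
counted? n k v = unique? (oneLine v) ×-dec (isDesarrangement? (oneLine v) ×-dec (des (oneLine v) ℕ.≟ k))

d : ℕ → ℕ → ℕ
d n k = length (filter (counted? n k) (words n n))

-- Poly : coefficient sequences in t (elements of ℤ[[t]] ⊇ ℤ[t]),
--   p j = coefficient of t^j.
-- Ser  : exponential power series in x over Poly,
--   A n = coefficient of x^n / n!  (a polynomial in t).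

Poly : Set
Poly = ℕ → ℤ

Ser : Set
Ser = ℕ → Poly

Σ≤ : ℕ → (ℕ → ℤ) → ℤ
Σ≤ zero    f = f 0
Σ≤ (suc n) f = Σ≤ n f + f (suc n)

0ₚ 1ₚ tₚ : Poly
0ₚ _ = + 0
1ₚ zero = + 1
1ₚ (suc _) = + 0
tₚ 1 = + 1
tₚ _ = + 0

_+ₚ_ _-ₚ_ _·ₚ_ : Poly → Poly → Poly
(p +ₚ q) j = p j + q j
(p -ₚ q) j = p j - q j
(p ·ₚ q) j = Σ≤ j (λ i → p i * q (j ∸ i))

-ₚ_ : Poly → Poly
(-ₚ p) j = - p j

_^ₚ_ : Poly → ℕ → Poly
p ^ₚ zero  = 1ₚ
p ^ₚ suc n = p ·ₚ (p ^ₚ n)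

infixl 6 _+ₚ_ _-ₚ_ _+ₛ_ _-ₛ_
infixl 7 _·ₚ_ _⋆_

_+ₛ_ _-ₛ_ _⋆_ : Ser → Ser → Ser
(A +ₛ B) n = A n +ₚ B n
(A -ₛ B) n = A n -ₚ B n
-- product of exponential generating functions (binomial convolution)
(A ⋆ B) n j = Σ≤ n (λ k → + (n C k) * (A k ·ₚ B (n ∸ k)) j)

const : Poly → Ser
const p zero    = p
const p (suc _) = 0ₚ

expₛ : Poly → Ser
expₛ p n = p ^ₚ n

Ddes : Ser
Ddes n k = + (d n k)

1-2t 1-t t-1 : Poly
1-2t = 1ₚ -ₚ tₚ -ₚ tₚ
1-t  = 1ₚ -ₚ tₚ
t-1  = tₚ -ₚ 1ₚ

module Submission where

-- Read a permutation from left to right. Its number of descents, and whether it is a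
-- desarrangement, depend only on the phase of its initial decreasing run (over, or of odd or
-- even length so far) and on the rank of each letter among the letters not used yet, so the
-- sum over permutations becomes a linear recursion over ranks. Pascal's rule solves that
-- recursion through the Eulerian polynomials A_n: with (1 - 2t) x_k = t ((-t)^k - (t - 1)^k)
-- and X the exponential generating function of (0, x_0, x_1, ...), one gets D = 1 + X A,
-- while (e^{(t-1)x} - t) A = 1 - t. Multiplying D by (1 - 2t) (e^{(t-1)x} - t) gives the formula.

open import Defs
open import Relation.Binary.PropositionalEquality using (_≡_)
open import Algebra.Bundles using (CommutativeRing)
open import Data.Nat as ℕ using (ℕ; zero; suc; _∸_; _<_; _≤_)
open import Data.Nat.Combinatorics using (_C_; k>n⇒nCk≡0; nCk≡nC[n∸k])

module Monus where

  open import Data.Nat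
  open import Data.Nat.Properties
  open import Relation.Binary.PropositionalEquality
  open ≡-Reasoning

  m∸n∸o≡m∸o∸n : ∀ m n o → m ∸ n ∸ o ≡ m ∸ o ∸ n
  m∸n∸o≡m∸o∸n m n o = begin
    m ∸ n ∸ o   ≡⟨ ∸-+-assoc m n o ⟩
    m ∸ (n + o) ≡⟨ cong (m ∸_) (+-comm n o) ⟩
    m ∸ (o + n) ≡⟨ ∸-+-assoc m o n ⟨
    m ∸ o ∸ n   ∎

  m+n≤o⇒n≤o∸m : ∀ m {n o} → m + n ≤ o → n ≤ o ∸ m
  m+n≤o⇒n≤o∸m m {n} {o} m+n≤o = m+n≤o⇒m≤o∸n n (subst (_≤ o) (+-comm m n) m+n≤o)

  o<m+n⇒o∸m<n : ∀ {m n o} → m ≤ o → o < m + n → o ∸ m < n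
  o<m+n⇒o∸m<n {m} {n} {o} m≤o o<m+n = subst (o ∸ m <_) (m+n∸m≡n m n) (∸-monoˡ-< o<m+n m≤o)

module TrinomialCoefficients where

  open import Data.Nat
  open import Data.Nat.Properties
  open import Data.Nat.Combinatorics
  open import Data.Nat.DivMod using (m/n*n≡m)
  open import Data.Nat.Solver using (module +-*-Solver)
  open import Relation.Nullary using (yes; no)
  open import Relation.Binary.PropositionalEquality
  open +-*-Solver
  open ≡-Reasoning
  open Monus

  nC0≡1 : ∀ n → n C 0 ≡ 1
  nC0≡1 n = refl

  nCk*k!*[n∸k]!≡n! : ∀ {n k} → k ≤ n → (n C k) * (k ! * (n ∸ k) !) ≡ n !
  nCk*k!*[n∸k]!≡n! {n} {k} k≤n = begin
    (n C k) * (k ! * (n ∸ k) !)                 ≡⟨ cong (_* (k ! * (n ∸ k) !)) (nCk≡n!/k![n-k]! k≤n) ⟩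
    n ! / (k ! * (n ∸ k) !) * (k ! * (n ∸ k) !) ≡⟨ m/n*n≡m (k![n∸k]!∣n! k≤n) ⟩
    n !                                         ∎
    where
    instance
      factorials≢0 : NonZero (k ! * (n ∸ k) !)
      factorials≢0 = k !* (n ∸ k) !≢0

  nCj*[n∸j]Ck*factorials≡n! : ∀ n j k → j + k ≤ n →
    (n C j) * ((n ∸ j) C k) * (j ! * k ! * (n ∸ j ∸ k) !) ≡ n !
  nCj*[n∸j]Ck*factorials≡n! n j k j+k≤n = begin
    (n C j) * ((n ∸ j) C k) * (j ! * k ! * (n ∸ j ∸ k) !)
      ≡⟨ solve 5 (λ a b x y z → a :* b :* (x :* y :* z) := a :* (x :* (b :* (y :* z))))
                 refl (n C j) ((n ∸ j) C k) (j !) (k !) ((n ∸ j ∸ k) !) ⟩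
    (n C j) * (j ! * (((n ∸ j) C k) * (k ! * (n ∸ j ∸ k) !)))
      ≡⟨ cong (λ m → (n C j) * (j ! * m)) (nCk*k!*[n∸k]!≡n! k≤n∸j) ⟩
    (n C j) * (j ! * (n ∸ j) !)
      ≡⟨ nCk*k!*[n∸k]!≡n! (m+n≤o⇒m≤o j j+k≤n) ⟩
    n ! ∎
    where
    k≤n∸j : k ≤ n ∸ j
    k≤n∸j = m+n≤o⇒n≤o∸m j j+k≤n

  nCj*[n∸j]Ck≡0 : ∀ n j k → n < j + k → (n C j) * ((n ∸ j) C k) ≡ 0
  nCj*[n∸j]Ck≡0 n j k n<j+k with j ≤? n
  ... | yes j≤n = trans (cong ((n C j) *_) (k>n⇒nCk≡0 (o<m+n⇒o∸m<n j≤n n<j+k))) (*-zeroʳ (n C j))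
  ... | no  j≰n = cong (_* ((n ∸ j) C k)) (k>n⇒nCk≡0 (≰⇒> j≰n))

  -- Both sides are the trinomial coefficient n! / (j! k! (n - j - k)!), or 0 if j + k > n.
  nCj*[n∸j]Ck≡nCk*[n∸k]Cj : ∀ n j k → (n C j) * ((n ∸ j) C k) ≡ (n C k) * ((n ∸ k) C j)
  nCj*[n∸j]Ck≡nCk*[n∸k]Cj n j k with j + k ≤? n
  ... | no j+k≰n = trans (nCj*[n∸j]Ck≡0 n j k n<j+k) (sym (nCj*[n∸j]Ck≡0 n k j (subst (n <_) (+-comm j k) n<j+k)))
    where
    n<j+k : n < j + k
    n<j+k = ≰⇒> j+k≰n
  ... | yes j+k≤n = *-cancelʳ-≡ _ _ (j ! * k ! * (n ∸ j ∸ k) !) {{factorials≢0}} (begin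
    (n C j) * ((n ∸ j) C k) * (j ! * k ! * (n ∸ j ∸ k) !)
      ≡⟨ nCj*[n∸j]Ck*factorials≡n! n j k j+k≤n ⟩
    n !
      ≡⟨ nCj*[n∸j]Ck*factorials≡n! n k j (subst (_≤ n) (+-comm j k) j+k≤n) ⟨
    (n C k) * ((n ∸ k) C j) * (k ! * j ! * (n ∸ k ∸ j) !)
      ≡⟨ cong₂ (λ a b → (n C k) * ((n ∸ k) C j) * (a * b !)) (*-comm (k !) (j !)) (m∸n∸o≡m∸o∸n n k j) ⟩
    (n C k) * ((n ∸ k) C j) * (j ! * k ! * (n ∸ j ∸ k) !) ∎)
    where
    factorials≢0 : NonZero (j ! * k ! * (n ∸ j ∸ k) !)
    factorials≢0 = m*n≢0 _ _ {{m*n≢0 _ _ {{j !≢0}} {{k !≢0}}}} {{(n ∸ j ∸ k) !≢0}}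

module UnusedLetters where

  open import Data.Nat.Properties as ℕ using (≤-refl; ≤-trans; ≤-pred; <⇒≤; n≤1+n; m≤n⇒m<n∨m≡n; <-irrefl)
  open import Data.Bool using (Bool; true; false; if_then_else_; _∨_; T)
  open import Data.Bool.Properties using (if-cong; if-float)
  open import Data.Empty using (⊥-elim)
  open import Data.Product using (_×_; _,_; proj₁)
  open import Data.Sum using (inj₁; inj₂)
  open import Data.Unit using (tt)
  open import Data.List using (List; []; _∷_)
  open import Data.List.Membership.DecPropositional ℕ._≟_ using (_∉_; _∈?_)
  open import Data.List.Relation.Unary.All as All using (All; []; _∷_)
  open import Data.List.Relation.Unary.AllPairs using ([]; _∷_)
  open import Data.List.Relation.Unary.Any using (here; there)
  open import Data.List.Relation.Unary.Unique.DecPropositional ℕ._≟_ using (Unique; unique?)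
  open import Function using (_∘_; mk⇔)
  open import Relation.Nullary using (does; yes; no)
  open import Relation.Nullary.Decidable using (dec-true; dec-false; does-⇔; T?)
  open import Relation.Binary.PropositionalEquality
  open ≡-Reasoning

  fresh : List ℕ → List ℕ → Bool
  fresh U []      = true
  fresh U (x ∷ l) = if does (x ∈? U) then false else fresh (x ∷ U) l

  fresh⇒unique : ∀ U l → T (fresh U l) → Unique l × All (_∉ U) l
  fresh⇒unique U []      _ = [] , []
  fresh⇒unique U (x ∷ l) isFresh with x ∈? U
  ... | yes _   = ⊥-elim isFresh
  ... | no  x∉U with fresh⇒unique (x ∷ U) l isFresh
  ...   | unique-l , l∉x∷U = All.map (λ y∉x∷U x≡y → y∉x∷U (here (sym x≡y))) l∉x∷U ∷ unique-l
                           , x∉U ∷ All.map (λ y∉x∷U → y∉x∷U ∘ there) l∉x∷U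

  unique⇒fresh : ∀ U l → Unique l → All (_∉ U) l → T (fresh U l)
  unique⇒fresh U []      _                _           = tt
  unique⇒fresh U (x ∷ l) (x≢l ∷ unique-l) (x∉U ∷ l∉U) with x ∈? U
  ... | yes x∈U = x∉U x∈U
  ... | no  _   = unique⇒fresh (x ∷ U) l unique-l (All.zipWith y∉x∷U (x≢l , l∉U))
    where
    y∉x∷U : ∀ {y} → x ≢ y × y ∉ U → y ∉ x ∷ U
    y∉x∷U (x≢y , y∉U) (here y≡x)  = x≢y (sym y≡x)
    y∉x∷U (x≢y , y∉U) (there y∈U) = y∉U y∈U

  fresh[]≡unique? : ∀ l → fresh [] l ≡ does (unique? l)
  fresh[]≡unique? l = does-⇔ (mk⇔ (proj₁ ∘ fresh⇒unique [] l) (λ u → unique⇒fresh [] l u (All.universal (λ _ ()) l)))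
                             (T? (fresh [] l)) (unique? l)

  unusedBelow : List ℕ → ℕ → ℕ
  unusedBelow U zero    = 0
  unusedBelow U (suc b) = if does (b ∈? U) then unusedBelow U b else suc (unusedBelow U b)

  unusedBelow-∉ : ∀ {U b} → b ∉ U → unusedBelow U (suc b) ≡ suc (unusedBelow U b)
  unusedBelow-∉ {U} {b} b∉U =
    cong (λ d → if d then unusedBelow U b else suc (unusedBelow U b)) (dec-false (b ∈? U) b∉U)

  unusedBelow-[] : ∀ b → unusedBelow [] b ≡ b
  unusedBelow-[] zero    = refl
  unusedBelow-[] (suc b) = cong suc (unusedBelow-[] b)

  unusedBelow-≤-suc : ∀ U b → unusedBelow U b ≤ unusedBelow U (suc b)
  unusedBelow-≤-suc U b with b ∈? U
  ... | yes _ = ≤-refl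
  ... | no  _ = n≤1+n _

  unusedBelow-mono : ∀ U {b b′} → b ≤ b′ → unusedBelow U b ≤ unusedBelow U b′
  unusedBelow-mono U {b′ = zero}   ℕ.z≤n = ≤-refl
  unusedBelow-mono U {b′ = suc b′} b≤1+b′ with m≤n⇒m<n∨m≡n b≤1+b′
  ... | inj₁ b<1+b′ = ≤-trans (unusedBelow-mono U (≤-pred b<1+b′)) (unusedBelow-≤-suc U b′)
  ... | inj₂ refl = ≤-refl

  unusedBelow-<ᵇ : ∀ {U i} a → i ∉ U → (i ℕ.<ᵇ a) ≡ (unusedBelow U i ℕ.<ᵇ unusedBelow U a)
  unusedBelow-<ᵇ {U} {i} a i∉U with i ℕ.<? a
  ... | yes i<a = trans (dec-true (i ℕ.<? a) i<a) (sym (dec-true (unusedBelow U i ℕ.<? unusedBelow U a)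
                          (subst (ℕ._≤ unusedBelow U a) (unusedBelow-∉ i∉U) (unusedBelow-mono U i<a))))
  ... | no  i≮a = trans (dec-false (i ℕ.<? a) i≮a) (sym (dec-false (unusedBelow U i ℕ.<? unusedBelow U a)
                          (ℕ.≤⇒≯ (unusedBelow-mono U (ℕ.≮⇒≥ i≮a)))))

  unusedBelow-cons-≤ : ∀ {U i} b → b ≤ i → unusedBelow (i ∷ U) b ≡ unusedBelow U b
  unusedBelow-cons-≤         zero    _     = refl
  unusedBelow-cons-≤ {U} {i} (suc b) b<i = trans
    (if-cong (cong (_∨ does (b ∈? U)) (dec-false (b ℕ.≟ i) (λ b≡i → <-irrefl b≡i b<i))))
    (cong (λ k → if does (b ∈? U) then k else suc k) (unusedBelow-cons-≤ b (<⇒≤ b<i)))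

  unusedBelow-cons-> : ∀ {U i} b → i ∉ U → i < b → suc (unusedBelow (i ∷ U) b) ≡ unusedBelow U b
  unusedBelow-cons-> {U} {i} (suc b) i∉U (ℕ.s≤s i≤b) with m≤n⇒m<n∨m≡n i≤b
  ... | inj₂ refl = begin
    suc (unusedBelow (i ∷ U) (suc i))
      ≡⟨ cong suc (if-cong (cong (_∨ does (i ∈? U)) (dec-true (i ℕ.≟ i) refl))) ⟩
    suc (unusedBelow (i ∷ U) i)
      ≡⟨ cong suc (unusedBelow-cons-≤ i ≤-refl) ⟩
    suc (unusedBelow U i)
      ≡⟨ unusedBelow-∉ i∉U ⟨
    unusedBelow U (suc i) ∎
  ... | inj₁ i<b = begin
    suc (unusedBelow (i ∷ U) (suc b))
      ≡⟨ cong suc (if-cong (cong (_∨ does (b ∈? U)) (dec-false (b ℕ.≟ i) (λ b≡i → <-irrefl (sym b≡i) i<b)))) ⟩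
    suc (if does (b ∈? U) then unusedBelow (i ∷ U) b else suc (unusedBelow (i ∷ U) b))
      ≡⟨ if-float suc (does (b ∈? U)) ⟩
    (if does (b ∈? U) then suc (unusedBelow (i ∷ U) b) else suc (suc (unusedBelow (i ∷ U) b)))
      ≡⟨ cong (λ k → if does (b ∈? U) then k else suc k) (unusedBelow-cons-> b i∉U i<b) ⟩
    unusedBelow U (suc b) ∎

module FiniteSums {c ℓ} (R : CommutativeRing c ℓ) where

  open import Data.Nat.Properties as ℕ using (m<n⇒m<1+n; ≤-refl; ≤-pred)
  open import Data.Sum using (inj₁; inj₂)
  open import Data.Bool using (true; false; if_then_else_)
  open import Relation.Nullary.Decidable using (dec-true; dec-false)
  import Relation.Binary.PropositionalEquality as ≡
  open CommutativeRing R
  open import Algebra.Properties.Ring ring using (-0#≈0#; -‿+-comm)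
  open import Algebra.Properties.CommutativeSemigroup +-commutativeSemigroup using (interchange)
  open import Relation.Binary.Reasoning.Setoid setoid

  ∑ : ℕ → (ℕ → Carrier) → Carrier
  ∑ zero    f = 0#
  ∑ (suc n) f = ∑ n f + f n

  syntax ∑ n (λ i → e) = ∑[ i < n ] e

  ∑-cong< : ∀ n {f g} → (∀ i → i < n → f i ≈ g i) → ∑ n f ≈ ∑ n g
  ∑-cong< zero    f≈g = refl
  ∑-cong< (suc n) f≈g = +-cong (∑-cong< n (λ i i<n → f≈g i (m<n⇒m<1+n i<n))) (f≈g n ≤-refl)

  ∑-cong : ∀ n {f g} → (∀ i → f i ≈ g i) → ∑ n f ≈ ∑ n g
  ∑-cong n f≈g = ∑-cong< n (λ i _ → f≈g i)

  ∑≈0 : ∀ n {f} → (∀ i → i < n → f i ≈ 0#) → ∑ n f ≈ 0#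
  ∑≈0 zero    f≈0 = refl
  ∑≈0 (suc n) f≈0 = trans (+-cong (∑≈0 n (λ i i<n → f≈0 i (m<n⇒m<1+n i<n))) (f≈0 n ≤-refl)) (+-identityˡ 0#)

  ∑-distrib-+ : ∀ n f g → ∑[ i < n ] (f i + g i) ≈ ∑ n f + ∑ n g
  ∑-distrib-+ zero    f g = sym (+-identityˡ 0#)
  ∑-distrib-+ (suc n) f g = trans (+-congʳ (∑-distrib-+ n f g)) (interchange _ _ _ _)

  -‿distrib-∑ : ∀ n f → ∑[ i < n ] (- f i) ≈ - ∑ n f
  -‿distrib-∑ zero    f = sym -0#≈0#
  -‿distrib-∑ (suc n) f = trans (+-congʳ (-‿distrib-∑ n f)) (-‿+-comm _ _)

  *-distribˡ-∑ : ∀ n a f → ∑[ i < n ] (a * f i) ≈ a * ∑ n f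
  *-distribˡ-∑ zero    a f = sym (zeroʳ a)
  *-distribˡ-∑ (suc n) a f = trans (+-congʳ (*-distribˡ-∑ n a f)) (sym (distribˡ _ _ _))

  ∑-shift : ∀ n f → ∑ (suc n) f ≈ f 0 + ∑[ i < n ] f (suc i)
  ∑-shift zero    f = trans (+-identityˡ _) (sym (+-identityʳ _))
  ∑-shift (suc n) f = trans (+-congʳ (∑-shift n f)) (+-assoc _ _ _)

  ∑-truncate : ∀ n r {f} → r ≤ n → (∀ i → r ≤ i → i < n → f i ≈ 0#) → ∑ n f ≈ ∑ r f
  ∑-truncate n r r≤n f≈0 with ℕ.m≤n⇒m<n∨m≡n r≤n
  ... | inj₂ ≡.refl = refl
  ∑-truncate (suc n) r r≤n f≈0 | inj₁ r<1+n = trans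
    (+-cong (∑-truncate n r (≤-pred r<1+n) (λ i r≤i i<n → f≈0 i r≤i (m<n⇒m<1+n i<n)))
            (f≈0 n (≤-pred r<1+n) ≤-refl))
    (+-identityʳ _)

  ∑-swap : ∀ m n (f : ℕ → ℕ → Carrier) → ∑[ i < m ] ∑[ j < n ] f i j ≈ ∑[ j < n ] ∑[ i < m ] f i j
  ∑-swap zero    n f = sym (∑≈0 n (λ _ _ → refl))
  ∑-swap (suc m) n f = trans (+-congʳ (∑-swap m n f)) (sym (∑-distrib-+ n _ _))

  ∑-linear : ∀ n x y f g → x * ∑ n f - y * ∑ n g ≈ ∑[ i < n ] (x * f i - y * g i)
  ∑-linear n x y f g = begin
    x * ∑ n f - y * ∑ n g                           ≈⟨ +-cong (*-distribˡ-∑ n x f) (-‿cong (*-distribˡ-∑ n y g)) ⟨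
    ∑[ i < n ] (x * f i) - ∑[ i < n ] (y * g i)     ≈⟨ +-congˡ (-‿distrib-∑ n _) ⟨
    ∑[ i < n ] (x * f i) + ∑[ i < n ] (- (y * g i)) ≈⟨ ∑-distrib-+ n _ _ ⟨
    ∑[ i < n ] (x * f i - y * g i)                  ∎

  ∑-if-< : ∀ n r (f g : ℕ → Carrier) → r ≤ n →
    ∑[ i < n ] (if i ℕ.<ᵇ r then f i else g i) ≈ ∑ n g + ∑[ i < r ] (f i - g i)
  ∑-if-< n r f g r≤n = begin
    ∑[ i < n ] (if i ℕ.<ᵇ r then f i else g i)              ≈⟨ ∑-cong n (λ i → split (i ℕ.<ᵇ r) (f i) (g i)) ⟩
    ∑[ i < n ] (g i + (if i ℕ.<ᵇ r then f i - g i else 0#)) ≈⟨ ∑-distrib-+ n _ _ ⟩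
    ∑ n g + ∑[ i < n ] (if i ℕ.<ᵇ r then f i - g i else 0#) ≈⟨ +-congˡ (∑-truncate n r r≤n beyond) ⟩
    ∑ n g + ∑[ i < r ] (if i ℕ.<ᵇ r then f i - g i else 0#) ≈⟨ +-congˡ (∑-cong< r below) ⟩
    ∑ n g + ∑[ i < r ] (f i - g i)                          ∎
    where
    split : ∀ b x y → (if b then x else y) ≈ y + (if b then x - y else 0#)
    split true  x y = sym (trans (+-comm y (x - y)) (trans (+-assoc x (- y) y)
                        (trans (+-congˡ (-‿inverseˡ y)) (+-identityʳ x))))
    split false x y = sym (+-identityʳ y)
    beyond : ∀ i → r ≤ i → i < n → (if i ℕ.<ᵇ r then f i - g i else 0#) ≈ 0#
    beyond i r≤i _ = reflexive (≡.cong (λ b → if b then f i - g i else 0#) (dec-false (i ℕ.<? r) (ℕ.≤⇒≯ r≤i)))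
    below : ∀ i → i < r → (if i ℕ.<ᵇ r then f i - g i else 0#) ≈ f i - g i
    below i i<r = reflexive (≡.cong (λ b → if b then f i - g i else 0#) (dec-true (i ℕ.<? r) i<r))

  ∑-reverse : ∀ n f → ∑ n f ≈ ∑[ i < n ] f (n ∸ suc i)
  ∑-reverse zero    f = refl
  ∑-reverse (suc n) f = begin
    ∑ n f + f n                     ≈⟨ +-congʳ (∑-reverse n f) ⟩
    ∑[ i < n ] f (n ∸ suc i) + f n  ≈⟨ +-comm _ _ ⟩
    f n + ∑[ i < n ] f (n ∸ suc i)  ≈⟨ ∑-shift n (λ i → f (n ∸ i)) ⟨
    ∑[ i < suc n ] f (n ∸ i)        ∎

-- Every commutative ring is a ℤ-algebra; the ring solver needs this to work over an arbitrary R.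
module IntegerCoefficients {c ℓ} (R : CommutativeRing c ℓ) where

  import Data.Nat.Properties as ℕ
  open import Data.Integer as ℤ using (ℤ; +_; -[1+_]; _⊖_)
  import Data.Integer.Properties as ℤ
  open import Data.Maybe using (Maybe; just; nothing)
  open import Relation.Nullary using (yes; no)
  import Relation.Binary.PropositionalEquality as ≡
  open import Algebra.Solver.Ring.AlmostCommutativeRing using (fromCommutativeRing; _-Raw-AlmostCommutative⟶_)
  open CommutativeRing R
  open import Algebra.Properties.Ring ring using (-0#≈0#; -‿involutive; -‿+-comm; -‿distribˡ-*; -‿distribʳ-*)
  open import Algebra.Properties.CommutativeSemigroup +-commutativeSemigroup using (interchange)
  open import Algebra.Properties.Semiring.Mult.TCOptimised semiring using (_×_; 1+×; ×-homo-+; ×1-homo-*)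
  open import Relation.Binary.Reasoning.Setoid setoid

  fromℕ : ℕ → Carrier
  fromℕ n = n × 1#

  fromℕ-+ : ∀ m n → fromℕ (m ℕ.+ n) ≈ fromℕ m + fromℕ n
  fromℕ-+ = ×-homo-+ 1#

  fromℕ-* : ∀ m n → fromℕ (m ℕ.* n) ≈ fromℕ m * fromℕ n
  fromℕ-* = ×1-homo-*

  fromℤ : ℤ → Carrier
  fromℤ (+ n)    = fromℕ n
  fromℤ -[1+ n ] = - fromℕ (suc n)

  fromℤ-‿homo : ∀ i → fromℤ (ℤ.- i) ≈ - fromℤ i
  fromℤ-‿homo (+ zero)  = sym -0#≈0#
  fromℤ-‿homo (+ suc n) = refl
  fromℤ-‿homo -[1+ n ]  = sym (-‿involutive _)

  fromℤ-⊖ : ∀ m n → fromℤ (m ⊖ n) ≈ fromℕ m - fromℕ n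
  fromℤ-⊖ zero    zero    = sym (-‿inverseʳ 0#)
  fromℤ-⊖ zero    (suc n) = sym (+-identityˡ _)
  fromℤ-⊖ (suc m) zero    = sym (trans (+-congˡ -0#≈0#) (+-identityʳ _))
  fromℤ-⊖ (suc m) (suc n) = begin
    fromℤ (suc m ⊖ suc n)             ≡⟨ ≡.cong fromℤ (ℤ.[1+m]⊖[1+n]≡m⊖n m n) ⟩
    fromℤ (m ⊖ n)                     ≈⟨ fromℤ-⊖ m n ⟩
    fromℕ m - fromℕ n                 ≈⟨ +-identityˡ _ ⟨
    0# + (fromℕ m - fromℕ n)          ≈⟨ +-congʳ (-‿inverseʳ 1#) ⟨
    (1# - 1#) + (fromℕ m - fromℕ n)   ≈⟨ interchange 1# (- 1#) (fromℕ m) (- fromℕ n) ⟩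
    (1# + fromℕ m) + (- 1# - fromℕ n) ≈⟨ +-congˡ (-‿+-comm 1# (fromℕ n)) ⟩
    (1# + fromℕ m) - (1# + fromℕ n)   ≈⟨ +-cong (1+× m 1#) (-‿cong (1+× n 1#)) ⟨
    fromℕ (suc m) - fromℕ (suc n)     ∎

  fromℤ-+ : ∀ i j → fromℤ (i ℤ.+ j) ≈ fromℤ i + fromℤ j
  fromℤ-+ (+ m)    (+ n)    = fromℕ-+ m n
  fromℤ-+ (+ m)    -[1+ n ] = fromℤ-⊖ m (suc n)
  fromℤ-+ -[1+ m ] (+ n)    = trans (fromℤ-⊖ n (suc m)) (+-comm _ _)
  fromℤ-+ -[1+ m ] -[1+ n ] = begin
    - fromℕ (suc (suc (m ℕ.+ n)))     ≡⟨ ≡.cong (λ k → - fromℕ (suc k)) (ℕ.+-suc m n) ⟨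
    - fromℕ (suc m ℕ.+ suc n)         ≈⟨ -‿cong (fromℕ-+ (suc m) (suc n)) ⟩
    - (fromℕ (suc m) + fromℕ (suc n)) ≈⟨ -‿+-comm _ _ ⟨
    - fromℕ (suc m) - fromℕ (suc n)   ∎

  fromℤ-*-+ : ∀ m n → fromℤ (+ m ℤ.* + n) ≈ fromℕ m * fromℕ n
  fromℤ-*-+ m n = trans (reflexive (≡.cong fromℤ (≡.sym (ℤ.pos-* m n)))) (fromℕ-* m n)

  fromℤ-* : ∀ i j → fromℤ (i ℤ.* j) ≈ fromℤ i * fromℤ j
  fromℤ-* (+ m) (+ n) = fromℤ-*-+ m n
  fromℤ-* (+ m) -[1+ n ] = begin
    fromℤ (+ m ℤ.* ℤ.- + suc n)   ≡⟨ ≡.cong fromℤ (ℤ.neg-distribʳ-* (+ m) (+ suc n)) ⟨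
    fromℤ (ℤ.- (+ m ℤ.* + suc n)) ≈⟨ fromℤ-‿homo (+ m ℤ.* + suc n) ⟩
    - fromℤ (+ m ℤ.* + suc n)     ≈⟨ -‿cong (fromℤ-*-+ m (suc n)) ⟩
    - (fromℕ m * fromℕ (suc n))   ≈⟨ -‿distribʳ-* _ _ ⟩
    fromℕ m * - fromℕ (suc n)     ∎
  fromℤ-* -[1+ m ] (+ n) = begin
    fromℤ (ℤ.- + suc m ℤ.* + n)   ≡⟨ ≡.cong fromℤ (ℤ.neg-distribˡ-* (+ suc m) (+ n)) ⟨
    fromℤ (ℤ.- (+ suc m ℤ.* + n)) ≈⟨ fromℤ-‿homo (+ suc m ℤ.* + n) ⟩
    - fromℤ (+ suc m ℤ.* + n)     ≈⟨ -‿cong (fromℤ-*-+ (suc m) n) ⟩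
    - (fromℕ (suc m) * fromℕ n)   ≈⟨ -‿distribˡ-* _ _ ⟩
    - fromℕ (suc m) * fromℕ n     ∎
  fromℤ-* -[1+ m ] -[1+ n ] = begin
    fromℤ (+ suc m ℤ.* + suc n)         ≈⟨ fromℤ-*-+ (suc m) (suc n) ⟩
    fromℕ (suc m) * fromℕ (suc n)       ≈⟨ -‿involutive _ ⟨
    - - (fromℕ (suc m) * fromℕ (suc n)) ≈⟨ -‿cong (-‿distribˡ-* _ _) ⟩
    - (- fromℕ (suc m) * fromℕ (suc n)) ≈⟨ -‿distribʳ-* _ _ ⟩
    - fromℕ (suc m) * - fromℕ (suc n)   ∎

  fromℤ-homomorphism :
    CommutativeRing.rawRing ℤ.+-*-commutativeRing -Raw-AlmostCommutative⟶ fromCommutativeRing R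
  fromℤ-homomorphism = record
    { ⟦_⟧    = fromℤ
    ; +-homo = fromℤ-+
    ; *-homo = fromℤ-*
    ; -‿homo = fromℤ-‿homo
    ; 0-homo = refl
    ; 1-homo = refl
    }

  fromℤ-≟ : ∀ i j → Maybe (fromℤ i ≈ fromℤ j)
  fromℤ-≟ i j with i ℤ.≟ j
  ... | yes i≡j = just (reflexive (≡.cong fromℤ i≡j))
  ... | no  _   = nothing

  open import Algebra.Solver.Ring (CommutativeRing.rawRing ℤ.+-*-commutativeRing)
    (fromCommutativeRing R) fromℤ-homomorphism fromℤ-≟ public

  :0 :1 : ∀ {n} → Polynomial n
  :0 = con (+ 0)
  :1 = con (+ 1)

module BinomialSums {c ℓ} (R : CommutativeRing c ℓ) where

  open import Data.Nat.Combinatorics using (_C_; nCk+nC[k+1]≡[n+1]C[k+1]; k>n⇒nCk≡0)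
  import Relation.Binary.PropositionalEquality as ≡
  open CommutativeRing R
  open import Relation.Binary.Reasoning.Setoid setoid
  open FiniteSums R
  open IntegerCoefficients R using (fromℕ; fromℕ-+)

  hockey-stick : ∀ r k x → ∑[ s < r ] (fromℕ (s C k) * x) ≈ fromℕ (r C suc k) * x
  hockey-stick zero    k x = sym (zeroˡ x)
  hockey-stick (suc r) k x = begin
    ∑[ s < r ] (fromℕ (s C k) * x) + fromℕ (r C k) * x
      ≈⟨ +-congʳ (hockey-stick r k x) ⟩
    fromℕ (r C suc k) * x + fromℕ (r C k) * x
      ≈⟨ distribʳ x _ _ ⟨
    (fromℕ (r C suc k) + fromℕ (r C k)) * x
      ≈⟨ *-congʳ (trans (+-comm _ _) (sym (fromℕ-+ (r C k) (r C suc k)))) ⟩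
    fromℕ ((r C k) ℕ.+ (r C suc k)) * x
      ≡⟨ ≡.cong (λ m → fromℕ m * x) (nCk+nC[k+1]≡[n+1]C[k+1] r k) ⟩
    fromℕ (suc r C suc k) * x ∎

  ∑-hockey-stick : ∀ r (x : ℕ → Carrier) →
    ∑[ s < r ] ∑[ k < suc s ] (fromℕ (s C k) * x k) ≈ ∑[ k < r ] (fromℕ (r C suc k) * x k)
  ∑-hockey-stick r x = begin
    ∑[ s < r ] ∑[ k < suc s ] (fromℕ (s C k) * x k)
      ≈⟨ ∑-cong< r (λ s s<r → ∑-truncate r (suc s) s<r (λ k s<k _ → vanish s<k)) ⟨
    ∑[ s < r ] ∑[ k < r ] (fromℕ (s C k) * x k)
      ≈⟨ ∑-swap r r _ ⟩
    ∑[ k < r ] ∑[ s < r ] (fromℕ (s C k) * x k)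
      ≈⟨ ∑-cong r (λ k → hockey-stick r k (x k)) ⟩
    ∑[ k < r ] (fromℕ (r C suc k) * x k) ∎
    where
    vanish : ∀ {s k} → s < k → fromℕ (s C k) * x k ≈ 0#
    vanish {s} {k} s<k = trans (reflexive (≡.cong (λ m → fromℕ m * x k) (k>n⇒nCk≡0 s<k))) (zeroˡ (x k))

-- Sequences under the convolution (a ⊛ b) n = ∑_{k ≤ n} ω n k a_k b_{n-k}: with ω n k = n C k this
-- is the product of exponential generating functions, with ω n k = [k ≤ n] that of power series.
module Convolution {c ℓ} (R : CommutativeRing c ℓ) (ω : ℕ → ℕ → ℕ)
    (ω-n-0      : ∀ n → ω n 0 ≡ 1)
    (ω-vanish   : ∀ {n k} → n < k → ω n k ≡ 0)
    (ω-sym      : ∀ {n k} → k ≤ n → ω n k ≡ ω n (n ∸ k))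
    (ω-exchange : ∀ n j k → ω n j ℕ.* ω (n ∸ j) k ≡ ω n k ℕ.* ω (n ∸ k) j)
  where

  open import Data.Nat.Properties as ℕ using (m∸n≤m; m∸[m∸n]≡n; ≤-pred)
  import Relation.Binary.PropositionalEquality as ≡
  open CommutativeRing R
  open import Algebra.Properties.CommutativeSemigroup *-commutativeSemigroup using (x∙yz≈y∙xz)
  open import Relation.Binary.Reasoning.Setoid setoid
  open FiniteSums R
  open IntegerCoefficients R using (fromℕ; fromℕ-*; solve; _:*_; _:=_)
  open Monus using (m∸n∸o≡m∸o∸n)

  constant : Carrier → ℕ → Carrier
  constant a zero    = a
  constant a (suc _) = 0#

  infixl 7 _⊛_

  _⊛_ : (ℕ → Carrier) → (ℕ → Carrier) → ℕ → Carrier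
  (a ⊛ b) n = ∑[ k < suc n ] (fromℕ (ω n k) * (a k * b (n ∸ k)))

  ⊛-cong : ∀ {a a′ b b′} → (∀ k → a k ≈ a′ k) → (∀ k → b k ≈ b′ k) → ∀ n → (a ⊛ b) n ≈ (a′ ⊛ b′) n
  ⊛-cong a≈a′ b≈b′ n = ∑-cong (suc n) (λ k → *-congˡ (*-cong (a≈a′ k) (b≈b′ (n ∸ k))))

  ⊛-congˡ : ∀ {a a′} b → (∀ k → a k ≈ a′ k) → ∀ n → (a ⊛ b) n ≈ (a′ ⊛ b) n
  ⊛-congˡ b a≈a′ = ⊛-cong a≈a′ (λ k → refl {b k})

  ⊛-congʳ : ∀ a {b b′} → (∀ k → b k ≈ b′ k) → ∀ n → (a ⊛ b) n ≈ (a ⊛ b′) n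
  ⊛-congʳ a b≈b′ = ⊛-cong (λ k → refl {a k}) b≈b′

  ⊛-distribˡ-+ : ∀ a b c n → (a ⊛ (λ k → b k + c k)) n ≈ (a ⊛ b) n + (a ⊛ c) n
  ⊛-distribˡ-+ a b c n = trans (∑-cong (suc n) (λ k → trans (*-congˡ (distribˡ _ _ _)) (distribˡ _ _ _)))
                               (∑-distrib-+ (suc n) _ _)

  ⊛-constantˡ : ∀ a b n → (constant a ⊛ b) n ≈ a * b n
  ⊛-constantˡ a b n = begin
    (constant a ⊛ b) n
      ≈⟨ ∑-shift n _ ⟩
    fromℕ (ω n 0) * (a * b n) + ∑[ k < n ] (fromℕ (ω n (suc k)) * (0# * b (n ∸ suc k)))
      ≈⟨ +-cong (*-congʳ (reflexive (≡.cong fromℕ (ω-n-0 n))))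
                (∑≈0 n (λ k _ → trans (*-congˡ (zeroˡ _)) (zeroʳ _))) ⟩
    1# * (a * b n) + 0#
      ≈⟨ trans (+-identityʳ _) (*-identityˡ _) ⟩
    a * b n ∎

  ⊛-comm : ∀ a b n → (a ⊛ b) n ≈ (b ⊛ a) n
  ⊛-comm a b n = begin
    (a ⊛ b) n                                                            ≈⟨ ∑-reverse (suc n) _ ⟩
    ∑[ k < suc n ] (fromℕ (ω n (n ∸ k)) * (a (n ∸ k) * b (n ∸ (n ∸ k)))) ≈⟨ ∑-cong< (suc n) reflected ⟩
    (b ⊛ a) n                                                            ∎
    where
    reflected : ∀ k → k < suc n → fromℕ (ω n (n ∸ k)) * (a (n ∸ k) * b (n ∸ (n ∸ k)))
                                 ≈ fromℕ (ω n k) * (b k * a (n ∸ k))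
    reflected k k<1+n = *-cong (reflexive (≡.cong fromℕ (≡.sym (ω-sym (≤-pred k<1+n)))))
      (trans (*-comm _ _) (*-congʳ (reflexive (≡.cong b (m∸[m∸n]≡n (≤-pred k<1+n))))))

  ⊛-constantʳ : ∀ a b n → (a ⊛ constant b) n ≈ b * a n
  ⊛-constantʳ a b n = trans (⊛-comm a (constant b) n) (⊛-constantˡ b a n)

  -- a ⊛ (b ⊛ c) is a double sum over j + k ≤ n (the other terms vanish by ω-vanish) whose
  -- terms are symmetric under (a , j) ↔ (b , k) by ω-exchange.
  private
    term : (a b c : ℕ → Carrier) (n j k : ℕ) → Carrier
    term a b c n j k = fromℕ (ω n j ℕ.* ω (n ∸ j) k) * (a j * (b k * c (n ∸ j ∸ k)))

    term-swap : ∀ a b c n j k → term a b c n j k ≈ term b a c n k j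
    term-swap a b c n j k = *-cong (reflexive (≡.cong fromℕ (ω-exchange n j k)))
      (trans (x∙yz≈y∙xz _ _ _) (*-congˡ (*-congˡ (reflexive (≡.cong c (m∸n∸o≡m∸o∸n n j k))))))

    ⊛⊛-double-sum : ∀ a b c n → (a ⊛ (b ⊛ c)) n ≈ ∑[ j < suc n ] ∑[ k < suc n ] term a b c n j k
    ⊛⊛-double-sum a b c n = ∑-cong (suc n) row
      where
      regroup : ∀ w a v x → w * (a * (v * x)) ≈ (w * v) * (a * x)
      regroup = solve 4 (λ w a v x → w :* (a :* (v :* x)) := (w :* v) :* (a :* x)) refl
      beyond : ∀ j k → suc (n ∸ j) ≤ k → k < suc n → term a b c n j k ≈ 0#
      beyond j k n∸j<k _ = trans (*-congʳ (reflexive (≡.cong fromℕ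
        (≡.trans (≡.cong (ω n j ℕ.*_) (ω-vanish n∸j<k)) (ℕ.*-zeroʳ (ω n j)))))) (zeroˡ _)
      row : ∀ j → fromℕ (ω n j) * (a j * (b ⊛ c) (n ∸ j)) ≈ ∑[ k < suc n ] term a b c n j k
      row j = begin
        fromℕ (ω n j) * (a j * (b ⊛ c) (n ∸ j))
          ≈⟨ *-congˡ (*-distribˡ-∑ (suc (n ∸ j)) (a j) _) ⟨
        fromℕ (ω n j) * ∑[ k < suc (n ∸ j) ] (a j * (fromℕ (ω (n ∸ j) k) * (b k * c (n ∸ j ∸ k))))
          ≈⟨ *-distribˡ-∑ (suc (n ∸ j)) _ _ ⟨
        ∑[ k < suc (n ∸ j) ] (fromℕ (ω n j) * (a j * (fromℕ (ω (n ∸ j) k) * (b k * c (n ∸ j ∸ k)))))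
          ≈⟨ ∑-cong (suc (n ∸ j)) (λ k → trans (regroup _ _ _ _)
                                                (*-congʳ (sym (fromℕ-* (ω n j) (ω (n ∸ j) k))))) ⟩
        ∑[ k < suc (n ∸ j) ] term a b c n j k
          ≈⟨ ∑-truncate (suc n) (suc (n ∸ j)) (ℕ.s≤s (m∸n≤m n j)) (beyond j) ⟨
        ∑[ k < suc n ] term a b c n j k ∎

  ⊛-exchange : ∀ a b c n → (a ⊛ (b ⊛ c)) n ≈ (b ⊛ (a ⊛ c)) n
  ⊛-exchange a b c n = begin
    (a ⊛ (b ⊛ c)) n
      ≈⟨ ⊛⊛-double-sum a b c n ⟩
    ∑[ j < suc n ] ∑[ k < suc n ] term a b c n j k
      ≈⟨ ∑-cong (suc n) (λ j → ∑-cong (suc n) (term-swap a b c n j)) ⟩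
    ∑[ j < suc n ] ∑[ k < suc n ] term b a c n k j
      ≈⟨ ∑-swap (suc n) (suc n) _ ⟩
    ∑[ k < suc n ] ∑[ j < suc n ] term b a c n k j
      ≈⟨ ⊛⊛-double-sum b a c n ⟨
    (b ⊛ (a ⊛ c)) n ∎

  ⊛-assoc : ∀ a b c n → ((a ⊛ b) ⊛ c) n ≈ (a ⊛ (b ⊛ c)) n
  ⊛-assoc a b c n = begin
    ((a ⊛ b) ⊛ c) n ≈⟨ ⊛-comm (a ⊛ b) c n ⟩
    (c ⊛ (a ⊛ b)) n ≈⟨ ⊛-exchange c a b n ⟩
    (a ⊛ (c ⊛ b)) n ≈⟨ ⊛-congʳ a (⊛-comm c b) n ⟩
    (a ⊛ (b ⊛ c)) n ∎

module BinomialConvolution {c ℓ} (R : CommutativeRing c ℓ) =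
  Convolution R _C_ TrinomialCoefficients.nC0≡1 k>n⇒nCk≡0 nCk≡nC[n∸k] TrinomialCoefficients.nCj*[n∸j]Ck≡nCk*[n∸k]Cj

module PolynomialRing where

  open import Level using (0ℓ)
  open import Data.Nat.Properties as ℕ using (≤-pred; m∸n≤m; m≤m+n; <-≤-trans; ≰⇒>)
  open import Data.Integer as ℤ using (ℤ; +_)
  import Data.Integer.Properties as ℤ
  open import Data.Bool using (if_then_else_)
  open import Data.Product using (_,_)
  open import Relation.Nullary using (yes; no)
  open import Relation.Nullary.Decidable using (dec-true; dec-false)
  open import Relation.Binary.PropositionalEquality using (refl; sym; trans; cong; cong₂; module ≡-Reasoning)
  import Algebra.Construct.Pointwise ℕ as Pointwise
  open ≡-Reasoning
  open Monus

  [_≤_] : ℕ → ℕ → ℕ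
  [ k ≤ n ] = if k ℕ.≤ᵇ n then 1 else 0

  [≤]-true : ∀ {k n} → k ≤ n → [ k ≤ n ] ≡ 1
  [≤]-true {k} {n} k≤n = cong (if_then 1 else 0) (dec-true (k ℕ.≤? n) k≤n)

  [≤]-false : ∀ {n k} → n < k → [ k ≤ n ] ≡ 0
  [≤]-false {n} {k} n<k = cong (if_then 1 else 0) (dec-false (k ℕ.≤? n) (ℕ.<⇒≱ n<k))

  [≤]-sym : ∀ {n k} → k ≤ n → [ k ≤ n ] ≡ [ n ∸ k ≤ n ]
  [≤]-sym {n} {k} k≤n = trans ([≤]-true k≤n) (sym ([≤]-true (m∸n≤m n k)))

  [j≤n]*[k≤n∸j]≡[j+k≤n] : ∀ n j k → [ j ≤ n ] ℕ.* [ k ≤ n ∸ j ] ≡ [ j ℕ.+ k ≤ n ]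
  [j≤n]*[k≤n∸j]≡[j+k≤n] n j k with j ℕ.≤? n | j ℕ.+ k ℕ.≤? n
  ... | yes j≤n | yes j+k≤n = trans (cong₂ ℕ._*_ ([≤]-true j≤n) ([≤]-true (m+n≤o⇒n≤o∸m j j+k≤n)))
                                    (sym ([≤]-true j+k≤n))
  ... | yes j≤n | no  j+k≰n = trans (cong₂ ℕ._*_ ([≤]-true j≤n) ([≤]-false (o<m+n⇒o∸m<n j≤n (≰⇒> j+k≰n))))
                                    (sym ([≤]-false (≰⇒> j+k≰n)))
  ... | no  j≰n | _         = trans (cong (ℕ._* [ k ≤ n ∸ j ]) ([≤]-false (≰⇒> j≰n)))
                                    (sym ([≤]-false (<-≤-trans (≰⇒> j≰n) (m≤m+n j k))))

  [≤]-exchange : ∀ n j k → [ j ≤ n ] ℕ.* [ k ≤ n ∸ j ] ≡ [ k ≤ n ] ℕ.* [ j ≤ n ∸ k ]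
  [≤]-exchange n j k = begin
    [ j ≤ n ] ℕ.* [ k ≤ n ∸ j ] ≡⟨ [j≤n]*[k≤n∸j]≡[j+k≤n] n j k ⟩
    [ j ℕ.+ k ≤ n ]             ≡⟨ cong [_≤ n ] (ℕ.+-comm j k) ⟩
    [ k ℕ.+ j ≤ n ]             ≡⟨ [j≤n]*[k≤n∸j]≡[j+k≤n] n k j ⟨
    [ k ≤ n ] ℕ.* [ j ≤ n ∸ k ] ∎

  open Convolution ℤ.+-*-commutativeRing (λ n k → [ k ≤ n ]) (λ _ → refl) [≤]-false [≤]-sym [≤]-exchange
  open FiniteSums ℤ.+-*-commutativeRing using (∑; ∑-cong<)
  open IntegerCoefficients ℤ.+-*-commutativeRing using (fromℕ)

  Σ≤≡∑ : ∀ n f → Σ≤ n f ≡ ∑ (suc n) f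
  Σ≤≡∑ zero    f = sym (ℤ.+-identityˡ (f 0))
  Σ≤≡∑ (suc n) f = cong (ℤ._+ f (suc n)) (Σ≤≡∑ n f)

  ·ₚ≗⊛ : ∀ p q j → (p ·ₚ q) j ≡ (p ⊛ q) j
  ·ₚ≗⊛ p q j = trans (Σ≤≡∑ j _) (∑-cong< (suc j) λ i i<1+j →
    trans (sym (ℤ.*-identityˡ (p i ℤ.* q (j ∸ i))))
          (cong (λ w → fromℕ w ℤ.* (p i ℤ.* q (j ∸ i))) (sym ([≤]-true (≤-pred i<1+j)))))

  _≈ₚ_ : Poly → Poly → Set
  p ≈ₚ q = ∀ j → p j ≡ q j

  ·ₚ-cong : ∀ {p p′ q q′} → p ≈ₚ p′ → q ≈ₚ q′ → (p ·ₚ q) ≈ₚ (p′ ·ₚ q′)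
  ·ₚ-cong {p} {p′} {q} {q′} p≈p′ q≈q′ j = begin
    (p ·ₚ q) j   ≡⟨ ·ₚ≗⊛ p q j ⟩
    (p ⊛ q) j    ≡⟨ ⊛-cong p≈p′ q≈q′ j ⟩
    (p′ ⊛ q′) j  ≡⟨ ·ₚ≗⊛ p′ q′ j ⟨
    (p′ ·ₚ q′) j ∎

  ·ₚ-comm : ∀ p q → (p ·ₚ q) ≈ₚ (q ·ₚ p)
  ·ₚ-comm p q j = trans (·ₚ≗⊛ p q j) (trans (⊛-comm p q j) (sym (·ₚ≗⊛ q p j)))

  ·ₚ-assoc : ∀ p q r → ((p ·ₚ q) ·ₚ r) ≈ₚ (p ·ₚ (q ·ₚ r))
  ·ₚ-assoc p q r j = begin
    ((p ·ₚ q) ·ₚ r) j ≡⟨ ·ₚ≗⊛ (p ·ₚ q) r j ⟩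
    ((p ·ₚ q) ⊛ r) j  ≡⟨ ⊛-congˡ r (·ₚ≗⊛ p q) j ⟩
    ((p ⊛ q) ⊛ r) j   ≡⟨ ⊛-assoc p q r j ⟩
    (p ⊛ (q ⊛ r)) j   ≡⟨ ⊛-congʳ p (·ₚ≗⊛ q r) j ⟨
    (p ⊛ (q ·ₚ r)) j  ≡⟨ ·ₚ≗⊛ p (q ·ₚ r) j ⟨
    (p ·ₚ (q ·ₚ r)) j ∎

  ·ₚ-identityˡ : ∀ q → (1ₚ ·ₚ q) ≈ₚ q
  ·ₚ-identityˡ q j = begin
    (1ₚ ·ₚ q) j            ≡⟨ ·ₚ≗⊛ 1ₚ q j ⟩
    (1ₚ ⊛ q) j             ≡⟨ ⊛-congˡ q 1ₚ≗constant j ⟩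
    (constant (+ 1) ⊛ q) j ≡⟨ ⊛-constantˡ (+ 1) q j ⟩
    + 1 ℤ.* q j            ≡⟨ ℤ.*-identityˡ (q j) ⟩
    q j                    ∎
    where
    1ₚ≗constant : 1ₚ ≈ₚ constant (+ 1)
    1ₚ≗constant zero    = refl
    1ₚ≗constant (suc _) = refl

  ·ₚ-distribˡ-+ₚ : ∀ p q r → (p ·ₚ (q +ₚ r)) ≈ₚ ((p ·ₚ q) +ₚ (p ·ₚ r))
  ·ₚ-distribˡ-+ₚ p q r j = begin
    (p ·ₚ (q +ₚ r)) j        ≡⟨ ·ₚ≗⊛ p (q +ₚ r) j ⟩
    (p ⊛ (q +ₚ r)) j         ≡⟨ ⊛-distribˡ-+ p q r j ⟩
    (p ⊛ q) j ℤ.+ (p ⊛ r) j  ≡⟨ cong₂ ℤ._+_ (·ₚ≗⊛ p q j) (·ₚ≗⊛ p r j) ⟨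
    ((p ·ₚ q) +ₚ (p ·ₚ r)) j ∎

  polyRing : CommutativeRing 0ℓ 0ℓ
  polyRing = record
    { Carrier = Poly ; _≈_ = _≈ₚ_ ; _+_ = _+ₚ_ ; _*_ = _·ₚ_ ; -_ = -ₚ_ ; 0# = 0ₚ ; 1# = 1ₚ
    ; isCommutativeRing = record
      { isRing = record
        { +-isAbelianGroup = Pointwise.isAbelianGroup ℤ.+-0-isAbelianGroup
        ; *-cong           = ·ₚ-cong
        ; *-assoc          = ·ₚ-assoc
        ; *-identity       = ·ₚ-identityˡ , λ q j → trans (·ₚ-comm q 1ₚ j) (·ₚ-identityˡ q j)
        ; distrib          = ·ₚ-distribˡ-+ₚ , λ p q r j → begin
            ((q +ₚ r) ·ₚ p) j        ≡⟨ ·ₚ-comm (q +ₚ r) p j ⟩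
            (p ·ₚ (q +ₚ r)) j        ≡⟨ ·ₚ-distribˡ-+ₚ p q r j ⟩
            ((p ·ₚ q) +ₚ (p ·ₚ r)) j ≡⟨ cong₂ ℤ._+_ (·ₚ-comm p q j) (·ₚ-comm p r j) ⟩
            ((q ·ₚ p) +ₚ (r ·ₚ p)) j ∎
        }
      ; *-comm = ·ₚ-comm
      }
    }

  ·ₚ-constantˡ : ∀ a p j → (constant a ·ₚ p) j ≡ a ℤ.* p j
  ·ₚ-constantˡ a p j = trans (·ₚ≗⊛ (constant a) p j) (⊛-constantˡ a p j)

  open import Algebra.Properties.Semiring.Mult.TCOptimised (CommutativeRing.semiring polyRing)
    using (_×_; 1+×)

  ×1ₚ≈constant : ∀ c → (c × 1ₚ) ≈ₚ constant (+ c)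
  ×1ₚ≈constant zero    zero    = refl
  ×1ₚ≈constant zero    (suc j) = refl
  ×1ₚ≈constant (suc c) zero    = trans (1+× c 1ₚ zero) (cong (ℤ._+_ (+ 1)) (×1ₚ≈constant c zero))
  ×1ₚ≈constant (suc c) (suc j) = trans (1+× c 1ₚ (suc j)) (cong (ℤ._+_ (+ 0)) (×1ₚ≈constant c (suc j)))

-- Reading a permutation from left to right, its phase is ascended once an ascent has been seen, and
-- otherwise records the parity of the length of the decreasing prefix read so far.
data Phase : Set where
  ascended oddRun evenRun : Phase

afterDescent : Phase → Phase
afterDescent ascended = ascended
afterDescent oddRun   = evenRun
afterDescent evenRun  = oddRun

module PhaseWeights {c ℓ} (R : CommutativeRing c ℓ) (t : CommutativeRing.Carrier R) where

  open import Data.List using (List; []; _∷_)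
  open import Data.Bool using (Bool; if_then_else_)
  open CommutativeRing R
  open FiniteSums R using (∑)

  -- A first ascent at an odd position (the end of the word counts as an ascent) gets weight 0.
  accept : Phase → Carrier
  accept oddRun = 0#
  accept _      = 1#

  step : Phase → Bool → (Phase → Carrier) → Carrier
  step p descent w = if descent then t * w (afterDescent p) else accept p * w ascended

  weight : Phase → ℕ → List ℕ → Carrier
  weight p a []      = accept p
  weight p a (b ∷ l) = step p (b ℕ.<ᵇ a) (λ q → weight q b l)

  -- The total weight of all continuations by n letters of a word whose last letter exceeds r of them.
  rankWeight : Phase → ℕ → ℕ → Carrier
  rankWeight p zero    r = accept p
  rankWeight p (suc n) r = ∑[ s < suc n ] step p (s ℕ.<ᵇ r) (λ q → rankWeight q n s)

  eulerian : ℕ → Carrier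
  eulerian n = rankWeight ascended n 0

  desarrangements : ℕ → Carrier
  desarrangements zero    = 1#
  desarrangements (suc n) = ∑[ s < suc n ] rankWeight oddRun n s

module WordSums {c ℓ} (R : CommutativeRing c ℓ) (t : CommutativeRing.Carrier R) where

  open import Data.Nat.Properties as ℕ using (≤-refl)
  open import Data.Bool using (Bool; true; false; if_then_else_)
  open import Data.List using (List; []; _∷_; map; concatMap; tabulate; allFin; _++_)
  open import Data.List.Membership.DecPropositional ℕ._≟_ using (_∈?_)
  open import Data.Fin using (Fin; toℕ)
  import Data.Fin as Fin
  import Data.Vec as Vec
  open import Relation.Nullary using (does; yes; no)
  open import Function using (id; _∘_)
  import Relation.Binary.PropositionalEquality as ≡
  open CommutativeRing R hiding (zero)
  open import Relation.Binary.Reasoning.Setoid setoid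
  open FiniteSums R
  open PhaseWeights R t
  open UnusedLetters

  ∑ₗ : ∀ {a} {A : Set a} → List A → (A → Carrier) → Carrier
  ∑ₗ []       f = 0#
  ∑ₗ (x ∷ xs) f = f x + ∑ₗ xs f

  ∑ₗ-++ : ∀ {a} {A : Set a} (xs ys : List A) f → ∑ₗ (xs ++ ys) f ≈ ∑ₗ xs f + ∑ₗ ys f
  ∑ₗ-++ []       ys f = sym (+-identityˡ _)
  ∑ₗ-++ (x ∷ xs) ys f = trans (+-congˡ (∑ₗ-++ xs ys f)) (sym (+-assoc _ _ _))

  ∑ₗ-concatMap : ∀ {a b} {A : Set a} {B : Set b} (g : A → List B) xs f →
    ∑ₗ (concatMap g xs) f ≈ ∑ₗ xs (λ x → ∑ₗ (g x) f)
  ∑ₗ-concatMap g []       f = refl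
  ∑ₗ-concatMap g (x ∷ xs) f = trans (∑ₗ-++ (g x) (concatMap g xs) f) (+-congˡ (∑ₗ-concatMap g xs f))

  ∑ₗ-map : ∀ {a b} {A : Set a} {B : Set b} (g : A → B) xs f → ∑ₗ (map g xs) f ≡ ∑ₗ xs (λ x → f (g x))
  ∑ₗ-map g []       f = ≡.refl
  ∑ₗ-map g (x ∷ xs) f = ≡.cong (f (g x) +_) (∑ₗ-map g xs f)

  ∑ₗ-cong : ∀ {a} {A : Set a} (xs : List A) {f g} → (∀ x → f x ≈ g x) → ∑ₗ xs f ≈ ∑ₗ xs g
  ∑ₗ-cong []       f≈g = refl
  ∑ₗ-cong (x ∷ xs) f≈g = +-cong (f≈g x) (∑ₗ-cong xs f≈g)

  ∑ₗ-*ˡ : ∀ {a} {A : Set a} (xs : List A) x f → ∑ₗ xs (λ y → x * f y) ≈ x * ∑ₗ xs f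
  ∑ₗ-*ˡ []       x f = sym (zeroʳ x)
  ∑ₗ-*ˡ (y ∷ xs) x f = trans (+-congˡ (∑ₗ-*ˡ xs x f)) (sym (distribˡ _ _ _))

  ∑ₗ-tabulate : ∀ {a} {A : Set a} m (g : Fin m → A) f (F : ℕ → Carrier) →
    (∀ i → f (g i) ≈ F (toℕ i)) → ∑ₗ (tabulate g) f ≈ ∑ m F
  ∑ₗ-tabulate zero    g f F f≈F = refl
  ∑ₗ-tabulate (suc m) g f F f≈F =
    trans (+-cong (f≈F Fin.zero) (∑ₗ-tabulate m (g ∘ Fin.suc) f (F ∘ suc) (f≈F ∘ Fin.suc))) (sym (∑-shift m F))

  letters : ∀ {m n} → Vec.Vec (Fin m) n → List ℕ
  letters w = map toℕ (Vec.toList w)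

  ∑words : ℕ → ℕ → (List ℕ → Carrier) → Carrier
  ∑words m n f = ∑ₗ (words m n) (λ w → f (letters w))

  ∑words-suc : ∀ m n f → ∑words m (suc n) f ≈ ∑[ i < m ] ∑words m n (λ l → f (i ∷ l))
  ∑words-suc m n f = begin
    ∑ₗ (concatMap (λ i → map (i Vec.∷_) (words m n)) (allFin m)) (λ w → f (letters w))
      ≈⟨ ∑ₗ-concatMap _ (allFin m) _ ⟩
    ∑ₗ (allFin m) (λ i → ∑ₗ (map (i Vec.∷_) (words m n)) (λ w → f (letters w)))
      ≈⟨ ∑ₗ-tabulate m id _ _ (λ i → reflexive (∑ₗ-map (i Vec.∷_) (words m n) _)) ⟩
    ∑[ i < m ] ∑words m n (λ l → f (i ∷ l)) ∎

  ∑words-≈0 : ∀ m n {f} → (∀ l → f l ≈ 0#) → ∑words m n f ≈ 0#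
  ∑words-≈0 m n f≈0 = trans (∑ₗ-cong (words m n) (λ w → f≈0 (letters w))) (∑ₗ-0 (words m n))
    where
    ∑ₗ-0 : ∀ {a} {A : Set a} (xs : List A) → ∑ₗ xs (λ _ → 0#) ≈ 0#
    ∑ₗ-0 []       = refl
    ∑ₗ-0 (x ∷ xs) = trans (+-identityˡ _) (∑ₗ-0 xs)

  ∑words-if-* : ∀ m n (g : List ℕ → Bool) x (f : List ℕ → Carrier) →
    ∑words m n (λ l → if g l then x * f l else 0#) ≈ x * ∑words m n (λ l → if g l then f l else 0#)
  ∑words-if-* m n g x f = trans (∑ₗ-cong (words m n) (λ w → if-* (g (letters w)) (f (letters w))))
                                (∑ₗ-*ˡ (words m n) x (λ w → if g (letters w) then f (letters w) else 0#))
    where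
    if-* : ∀ b y → (if b then x * y else 0#) ≈ x * (if b then y else 0#)
    if-* true  y = refl
    if-* false y = sym (zeroʳ x)

  ∑words-step : ∀ m n (g : List ℕ → Bool) p b (w : List ℕ → Phase → Carrier) →
    ∑words m n (λ l → if g l then step p b (w l) else 0#)
      ≈ step p b (λ q → ∑words m n (λ l → if g l then w l q else 0#))
  ∑words-step m n g p true  w = ∑words-if-* m n g t (λ l → w l (afterDescent p))
  ∑words-step m n g p false w = ∑words-if-* m n g (accept p) (λ l → w l ascended)

  ∑-unused : ∀ U m (g : ℕ → Carrier) →
    ∑[ i < m ] (if does (i ∈? U) then 0# else g (unusedBelow U i)) ≈ ∑[ s < unusedBelow U m ] g s
  ∑-unused U zero    g = refl
  ∑-unused U (suc m) g with m ∈? U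
  ... | yes _ = trans (+-identityʳ _) (∑-unused U m g)
  ... | no  _ = +-congʳ (∑-unused U m g)

  step-cong : ∀ p b {w w′} → (∀ q → w q ≈ w′ q) → step p b w ≈ step p b w′
  step-cong p true  w≈w′ = *-congˡ (w≈w′ (afterDescent p))
  step-cong p false w≈w′ = *-congˡ (w≈w′ ascended)

  -- Choosing the next letter i amounts to choosing its rank among the unused letters, and comparing
  -- i with the previous letter a amounts to comparing their ranks.
  rankWeight-counts : ∀ n m U p a → unusedBelow U m ≡ n →
    ∑words m n (λ l → if fresh U l then weight p a l else 0#) ≈ rankWeight p n (unusedBelow U a)
  rankWeight-counts zero    m U p a _ = +-identityʳ (accept p)
  rankWeight-counts (suc n) m U p a unused≡1+n = begin
    ∑words m (suc n) (λ l → if fresh U l then weight p a l else 0#)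
      ≈⟨ ∑words-suc m n (λ l → if fresh U l then weight p a l else 0#) ⟩
    ∑[ i < m ] ∑words m n (λ l → if fresh U (i ∷ l) then weight p a (i ∷ l) else 0#)
      ≈⟨ ∑-cong< m firstLetter ⟩
    ∑[ i < m ] (if does (i ∈? U) then 0# else next (unusedBelow U i))
      ≈⟨ ∑-unused U m next ⟩
    ∑[ s < unusedBelow U m ] next s
      ≡⟨ ≡.cong (λ k → ∑ k next) unused≡1+n ⟩
    rankWeight p (suc n) (unusedBelow U a) ∎
    where
    next : ℕ → Carrier
    next s = step p (s ℕ.<ᵇ unusedBelow U a) (λ q → rankWeight q n s)
    firstLetter : ∀ i → i < m → ∑words m n (λ l → if fresh U (i ∷ l) then weight p a (i ∷ l) else 0#)
                              ≈ (if does (i ∈? U) then 0# else next (unusedBelow U i))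
    firstLetter i i<m with i ∈? U
    ... | yes _   = ∑words-≈0 m n (λ l → refl)
    ... | no  i∉U = begin
      ∑words m n (λ l → if fresh (i ∷ U) l then step p (i ℕ.<ᵇ a) (λ q → weight q i l) else 0#)
        ≈⟨ ∑words-step m n (fresh (i ∷ U)) p (i ℕ.<ᵇ a) (λ l q → weight q i l) ⟩
      step p (i ℕ.<ᵇ a) (λ q → ∑words m n (λ l → if fresh (i ∷ U) l then weight q i l else 0#))
        ≈⟨ step-cong p (i ℕ.<ᵇ a) (λ q → rankWeight-counts n m (i ∷ U) q i unused′) ⟩
      step p (i ℕ.<ᵇ a) (λ q → rankWeight q n (unusedBelow (i ∷ U) i))
        ≡⟨ ≡.cong₂ (λ b r → step p b (λ q → rankWeight q n r))
                   (unusedBelow-<ᵇ a i∉U) (unusedBelow-cons-≤ i ≤-refl) ⟩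
      next (unusedBelow U i) ∎
      where
      unused′ : unusedBelow (i ∷ U) m ≡ n
      unused′ = ℕ.suc-injective (≡.trans (unusedBelow-cons-> m i∉U i<m) unused≡1+n)

  permutationWeight : List ℕ → Carrier
  permutationWeight []      = 1#
  permutationWeight (a ∷ l) = weight oddRun a l

  desarrangements-counts : ∀ n →
    ∑words n n (λ l → if fresh [] l then permutationWeight l else 0#) ≈ desarrangements n
  desarrangements-counts zero    = +-identityʳ 1#
  desarrangements-counts (suc n) = begin
    ∑words (suc n) (suc n) (λ l → if fresh [] l then permutationWeight l else 0#)
      ≈⟨ ∑words-suc (suc n) n (λ l → if fresh [] l then permutationWeight l else 0#) ⟩
    ∑[ i < suc n ] ∑words (suc n) n (λ l → if fresh (i ∷ []) l then weight oddRun i l else 0#)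
      ≈⟨ ∑-cong< (suc n) firstLetter ⟩
    desarrangements (suc n) ∎
    where
    firstLetter : ∀ i → i < suc n →
      ∑words (suc n) n (λ l → if fresh (i ∷ []) l then weight oddRun i l else 0#) ≈ rankWeight oddRun n i
    firstLetter i i<1+n = begin
      ∑words (suc n) n (λ l → if fresh (i ∷ []) l then weight oddRun i l else 0#)
        ≈⟨ rankWeight-counts n (suc n) (i ∷ []) oddRun i unused ⟩
      rankWeight oddRun n (unusedBelow (i ∷ []) i)
        ≡⟨ ≡.cong (rankWeight oddRun n) (≡.trans (unusedBelow-cons-≤ i ≤-refl) (unusedBelow-[] i)) ⟩
      rankWeight oddRun n i ∎
      where
      unused : unusedBelow (i ∷ []) (suc n) ≡ n
      unused = ℕ.suc-injective (≡.trans (unusedBelow-cons-> (suc n) (λ ()) i<1+n)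
                                        (unusedBelow-[] (suc n)))

module ClosedForms {c ℓ} (R : CommutativeRing c ℓ) (t : CommutativeRing.Carrier R) where

  open import Data.Nat.Properties using (≤-pred; <-≤-trans)
  open import Data.Integer using (+_)
  open CommutativeRing R hiding (zero)
  open import Algebra.Properties.Semiring.Exp semiring using (_^_)
  open import Relation.Binary.Reasoning.Setoid setoid
  open FiniteSums R
  open BinomialSums R
  open IntegerCoefficients R using (fromℕ; solve; _:+_; _:*_; _:-_; :-_; _:=_; :0; :1)
  open PhaseWeights R t
  open BinomialConvolution R

  -- Mirrors the recursion of step, shifted in k: summing closedForm over the ranks s < r raises
  -- k by one (∑-hockey-stick).
  phaseCoeff : Phase → ℕ → Carrier
  phaseCoeff p zero    = accept p
  phaseCoeff p (suc k) = t * phaseCoeff (afterDescent p) k - accept p * phaseCoeff ascended k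

  closedForm : (ℕ → Carrier) → ℕ → ℕ → Carrier
  closedForm a n r = ∑[ k < suc r ] (fromℕ (r C k) * (a k * eulerian (n ∸ k)))

  closedForm-linear : ∀ x y a b n r →
    x * closedForm a n r - y * closedForm b n r ≈ closedForm (λ k → x * a k - y * b k) n r
  closedForm-linear x y a b n r =
    trans (∑-linear (suc r) x y _ _) (∑-cong (suc r) (λ k → distribute _ _ _ _))
    where
    distribute : ∀ c a b e → x * (c * (a * e)) - y * (c * (b * e)) ≈ c * ((x * a - y * b) * e)
    distribute = solve 6 (λ x y c a b e → x :* (c :* (a :* e)) :- y :* (c :* (b :* e))
                                      := c :* ((x :* a :- y :* b) :* e)) refl x y

  closedForm-suc : ∀ a n r → closedForm a (suc n) r ≈
    a 0 * eulerian (suc n) + ∑[ k < r ] (fromℕ (r C suc k) * (a (suc k) * eulerian (n ∸ k)))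
  closedForm-suc a n r = trans (∑-shift r _) (+-congʳ (*-identityˡ _))

  eulerian-suc : ∀ n → eulerian (suc n) ≈ ∑[ s < suc n ] rankWeight ascended n s
  eulerian-suc n = ∑-cong (suc n) (λ s → *-identityˡ _)

  rankWeight-suc : ∀ p n r → r ≤ suc n → rankWeight p (suc n) r ≈ accept p * eulerian (suc n)
    + ∑[ s < r ] (t * rankWeight (afterDescent p) n s - accept p * rankWeight ascended n s)
  rankWeight-suc p n r r≤1+n = trans (∑-if-< (suc n) r _ _ r≤1+n)
    (+-congʳ (trans (*-distribˡ-∑ (suc n) (accept p) _) (*-congˡ (sym (eulerian-suc n)))))

  rankWeight-closed : ∀ p n r → r ≤ n → rankWeight p n r ≈ closedForm (phaseCoeff p) n r
  rankWeight-closed p zero    .zero ℕ.z≤n =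
    sym (trans (+-identityˡ _) (trans (*-identityˡ _) (*-identityʳ _)))
  rankWeight-closed p (suc n) r r≤1+n = begin
    rankWeight p (suc n) r
      ≈⟨ rankWeight-suc p n r r≤1+n ⟩
    accept p * eulerian (suc n)
      + ∑[ s < r ] (t * rankWeight (afterDescent p) n s - accept p * rankWeight ascended n s)
      ≈⟨ +-congˡ (∑-cong< r (λ s s<r → +-cong (*-congˡ (IH (afterDescent p) s<r))
                                               (-‿cong (*-congˡ (IH ascended s<r))))) ⟩
    accept p * eulerian (suc n) + ∑[ s < r ] (t * closedForm (phaseCoeff (afterDescent p)) n s
                                              - accept p * closedForm (phaseCoeff ascended) n s)
      ≈⟨ +-congˡ (∑-cong r (closedForm-linear t (accept p) _ _ n)) ⟩
    accept p * eulerian (suc n) + ∑[ s < r ] closedForm (λ k → phaseCoeff p (suc k)) n s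
      ≈⟨ +-congˡ (∑-hockey-stick r _) ⟩
    accept p * eulerian (suc n)
      + ∑[ k < r ] (fromℕ (r C suc k) * (phaseCoeff p (suc k) * eulerian (n ∸ k)))
      ≈⟨ closedForm-suc (phaseCoeff p) n r ⟨
    closedForm (phaseCoeff p) (suc n) r ∎
    where
    IH : ∀ q {s} → s < r → rankWeight q n s ≈ closedForm (phaseCoeff q) n s
    IH q {s} s<r = rankWeight-closed q n s (≤-pred (<-≤-trans s<r r≤1+n))

  ∑-rankWeight : ∀ p n → ∑[ s < suc n ] rankWeight p n s ≈
    ∑[ k < suc n ] (fromℕ (suc n C suc k) * (phaseCoeff p k * eulerian (n ∸ k)))
  ∑-rankWeight p n = trans (∑-cong< (suc n) (λ s s<1+n → rankWeight-closed p n s (≤-pred s<1+n)))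
                           (∑-hockey-stick (suc n) _)

  phaseCoeff-ascended : ∀ k → phaseCoeff ascended k ≈ (t - 1#) ^ k
  phaseCoeff-ascended zero    = refl
  phaseCoeff-ascended (suc k) = begin
    t * phaseCoeff ascended k - 1# * phaseCoeff ascended k
      ≈⟨ solve 2 (λ t x → t :* x :- :1 :* x := (t :- :1) :* x) refl t _ ⟩
    (t - 1#) * phaseCoeff ascended k
      ≈⟨ *-congˡ (phaseCoeff-ascended k) ⟩
    (t - 1#) * (t - 1#) ^ k ∎

  phaseCoeff-oddRun : ∀ m → (1# - t - t) * phaseCoeff oddRun m ≈ t * ((- t) ^ m - (t - 1#) ^ m)
  phaseCoeff-oddRun zero          = solve 1 (λ t → (:1 :- t :- t) :* :0 := t :* (:1 :- :1)) refl t
  phaseCoeff-oddRun (suc zero)    = solve 1 (λ t → (:1 :- t :- t) :* (t :* :1 :- :0 :* :1)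
                                                 := t :* ((:- t) :* :1 :- (t :- :1) :* :1)) refl t
  phaseCoeff-oddRun (suc (suc m)) = begin
    (1# - t - t)
      * (t * (t * phaseCoeff oddRun m - 1# * phaseCoeff ascended m) - 0# * phaseCoeff ascended (suc m))
      ≈⟨ solve 4 (λ t x p q → (:1 :- t :- t) :* (t :* (t :* x :- :1 :* p) :- :0 :* q)
                           := t :* t :* ((:1 :- t :- t) :* x) :- t :* (:1 :- t :- t) :* p) refl t _ _ _ ⟩
    t * t * ((1# - t - t) * phaseCoeff oddRun m) - t * (1# - t - t) * phaseCoeff ascended m
      ≈⟨ +-cong (*-congˡ (phaseCoeff-oddRun m)) (-‿cong (*-congˡ (phaseCoeff-ascended m))) ⟩
    t * t * (t * ((- t) ^ m - (t - 1#) ^ m)) - t * (1# - t - t) * (t - 1#) ^ m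
      ≈⟨ solve 3 (λ t v u → t :* t :* (t :* (v :- u)) :- t :* (:1 :- t :- t) :* u
                         := t :* ((:- t) :* ((:- t) :* v) :- (t :- :1) :* ((t :- :1) :* u))) refl t _ _ ⟩
    t * ((- t) ^ suc (suc m) - (t - 1#) ^ suc (suc m)) ∎

  oddShift : ℕ → Carrier
  oddShift zero    = 0#
  oddShift (suc k) = phaseCoeff oddRun k

  desarrangements-as-convolution : ∀ n → desarrangements n ≈ constant 1# n + (oddShift ⊛ eulerian) n
  desarrangements-as-convolution zero    =
    sym (trans (+-congˡ (trans (+-identityˡ _) (trans (*-identityˡ _) (zeroˡ _)))) (+-identityʳ _))
  desarrangements-as-convolution (suc n) = begin
    desarrangements (suc n)
      ≈⟨ ∑-rankWeight oddRun n ⟩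
    ∑[ k < suc n ] (fromℕ (suc n C suc k) * (oddShift (suc k) * eulerian (n ∸ k)))
      ≈⟨ trans (+-congʳ (trans (*-identityˡ _) (zeroˡ _))) (+-identityˡ _) ⟨
    1# * (oddShift 0 * eulerian (suc n))
      + ∑[ k < suc n ] (fromℕ (suc n C suc k) * (oddShift (suc k) * eulerian (n ∸ k)))
      ≈⟨ ∑-shift (suc n) _ ⟨
    (oddShift ⊛ eulerian) (suc n)
      ≈⟨ +-identityˡ _ ⟨
    0# + (oddShift ⊛ eulerian) (suc n) ∎

  -- The coefficients of e^{(t-1)x} - t and of 1 - 2t - e^{-tx} + e^{(t-1)x}.
  denominator numerator : ℕ → Carrier
  denominator k = (t - 1#) ^ k - constant t k
  numerator   k = constant (1# - t - t) k - (- t) ^ k + (t - 1#) ^ k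

  denominator⊛eulerian : ∀ n → (denominator ⊛ eulerian) n ≈ constant (1# - t) n
  denominator⊛eulerian zero    = trans (+-identityˡ _) (trans (*-identityˡ _) (*-identityʳ _))
  denominator⊛eulerian (suc n) = begin
    (denominator ⊛ eulerian) (suc n)
      ≈⟨ ∑-shift (suc n) _ ⟩
    1# * ((1# - t) * eulerian (suc n))
      + ∑[ k < suc n ] (fromℕ (suc n C suc k) * (denominator (suc k) * eulerian (n ∸ k)))
      ≈⟨ +-congˡ (trans (∑-cong (suc n) pull) (*-distribˡ-∑ (suc n) (t - 1#) _)) ⟩
    1# * ((1# - t) * eulerian (suc n))
      + (t - 1#) * ∑[ k < suc n ] (fromℕ (suc n C suc k) * (phaseCoeff ascended k * eulerian (n ∸ k)))
      ≈⟨ +-congˡ (*-congˡ (trans (eulerian-suc n) (∑-rankWeight ascended n))) ⟨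
    1# * ((1# - t) * eulerian (suc n)) + (t - 1#) * eulerian (suc n)
      ≈⟨ solve 2 (λ t e → :1 :* ((:1 :- t) :* e) :+ (t :- :1) :* e := :0) refl t _ ⟩
    0# ∎
    where
    pull : ∀ k → fromℕ (suc n C suc k) * (denominator (suc k) * eulerian (n ∸ k))
               ≈ (t - 1#) * (fromℕ (suc n C suc k) * (phaseCoeff ascended k * eulerian (n ∸ k)))
    pull k = trans (*-congˡ (*-congʳ (+-congʳ (*-congˡ (sym (phaseCoeff-ascended k))))))
      (solve 4 (λ t c p e → c :* (((t :- :1) :* p :- :0) :* e) := (t :- :1) :* (c :* (p :* e)))
               refl t _ _ _)

  denominator⊛desarrangements : ∀ n →
    (denominator ⊛ desarrangements) n ≈ denominator n + (1# - t) * oddShift n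
  denominator⊛desarrangements n = begin
    (denominator ⊛ desarrangements) n
      ≈⟨ ⊛-congʳ denominator desarrangements-as-convolution n ⟩
    (denominator ⊛ (λ k → constant 1# k + (oddShift ⊛ eulerian) k)) n
      ≈⟨ ⊛-distribˡ-+ denominator (constant 1#) (oddShift ⊛ eulerian) n ⟩
    (denominator ⊛ constant 1#) n + (denominator ⊛ (oddShift ⊛ eulerian)) n
      ≈⟨ +-cong (trans (⊛-constantʳ denominator 1# n) (*-identityˡ (denominator n)))
                (⊛-exchange denominator oddShift eulerian n) ⟩
    denominator n + (oddShift ⊛ (denominator ⊛ eulerian)) n
      ≈⟨ +-congˡ (⊛-congʳ oddShift denominator⊛eulerian n) ⟩
    denominator n + (oddShift ⊛ constant (1# - t)) n
      ≈⟨ +-congˡ (⊛-constantʳ oddShift (1# - t) n) ⟩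
    denominator n + (1# - t) * oddShift n ∎

  denominator⊛desarrangements-scaled : ∀ n →
    (1# - t - t) * (denominator ⊛ desarrangements) n ≈ (1# - t) * numerator n
  denominator⊛desarrangements-scaled n = trans (*-congˡ (denominator⊛desarrangements n)) (scaled n)
    where
    scaled : ∀ n → (1# - t - t) * (denominator n + (1# - t) * oddShift n) ≈ (1# - t) * numerator n
    scaled zero    = solve 1 (λ t → (:1 :- t :- t) :* ((:1 :- t) :+ (:1 :- t) :* :0)
                                 := (:1 :- t) :* ((:1 :- t :- t) :- :1 :+ :1)) refl t
    scaled (suc m) = begin
      (1# - t - t) * (((t - 1#) * (t - 1#) ^ m - 0#) + (1# - t) * phaseCoeff oddRun m)
        ≈⟨ solve 3 (λ t u x → (:1 :- t :- t) :* (((t :- :1) :* u :- :0) :+ (:1 :- t) :* x)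
                           := (:1 :- t :- t) :* ((t :- :1) :* u) :+ (:1 :- t) :* ((:1 :- t :- t) :* x))
                   refl t _ _ ⟩
      (1# - t - t) * ((t - 1#) * (t - 1#) ^ m) + (1# - t) * ((1# - t - t) * phaseCoeff oddRun m)
        ≈⟨ +-congˡ (*-congˡ (phaseCoeff-oddRun m)) ⟩
      (1# - t - t) * ((t - 1#) * (t - 1#) ^ m) + (1# - t) * (t * ((- t) ^ m - (t - 1#) ^ m))
        ≈⟨ solve 3 (λ t u v → (:1 :- t :- t) :* ((t :- :1) :* u) :+ (:1 :- t) :* (t :* (v :- u))
                           := (:1 :- t) :* (:0 :- (:- t) :* v :+ (t :- :1) :* u)) refl t _ _ ⟩
      (1# - t) * numerator (suc m) ∎

  desarrangement-egf : ∀ n →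
    ((constant (1# - t - t) ⊛ denominator) ⊛ desarrangements) n ≈ (constant (1# - t) ⊛ numerator) n
  desarrangement-egf n = begin
    ((constant (1# - t - t) ⊛ denominator) ⊛ desarrangements) n
      ≈⟨ ⊛-assoc (constant (1# - t - t)) denominator desarrangements n ⟩
    (constant (1# - t - t) ⊛ (denominator ⊛ desarrangements)) n
      ≈⟨ ⊛-constantˡ (1# - t - t) (denominator ⊛ desarrangements) n ⟩
    (1# - t - t) * (denominator ⊛ desarrangements) n
      ≈⟨ denominator⊛desarrangements-scaled n ⟩
    (1# - t) * numerator n
      ≈⟨ ⊛-constantˡ (1# - t) numerator n ⟨
    (constant (1# - t) ⊛ numerator) n ∎

module PermutationCoefficients where

  open import Data.Integer as ℤ using (ℤ; +_)
  import Data.Integer.Properties as ℤ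
  open import Data.Bool using (Bool; true; false; if_then_else_; not; _∧_)
  open import Data.Bool.Properties using (not-involutive; ∧-zeroʳ; ∧-comm)
  open import Data.Fin using (Fin)
  open import Data.List using (List; []; _∷_; filter; length)
  open import Data.List.Relation.Unary.Unique.DecPropositional ℕ._≟_ using (unique?)
  open import Data.Vec using (Vec)
  open import Relation.Nullary using (does)
  open import Relation.Unary using (Decidable)
  open import Relation.Binary.PropositionalEquality
  open PolynomialRing using (polyRing; _≈ₚ_; Σ≤≡∑)
  open CommutativeRing polyRing using (*-identityˡ; zeroˡ)
  open PhaseWeights polyRing tₚ
  open WordSums polyRing tₚ using (∑ₗ; letters; permutationWeight; desarrangements-counts)
  open UnusedLetters using (fresh; fresh[]≡unique?)
  module ℤ∑ = FiniteSums ℤ.+-*-commutativeRing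
  open ℤ∑ using (∑)

  indicator : Bool → ℤ
  indicator b = if b then + 1 else + 0

  isEven : ℕ → Bool
  isEven zero    = true
  isEven (suc n) = not (isEven n)

  isEven≡[%2≡ᵇ0] : ∀ n → isEven n ≡ (n ℕ.% 2 ℕ.≡ᵇ 0)
  isEven≡[%2≡ᵇ0] 0             = refl
  isEven≡[%2≡ᵇ0] 1             = refl
  isEven≡[%2≡ᵇ0] (suc (suc n)) = trans (not-involutive (isEven n)) (isEven≡[%2≡ᵇ0] n)

  -- Whether, in phase p, a first ascent at position f of the rest of the word makes a desarrangement.
  accepts : Phase → ℕ → Bool
  accepts ascended _ = true
  accepts oddRun   f = isEven f
  accepts evenRun  f = not (isEven f)

  accepts-suc : ∀ p f → accepts p (suc f) ≡ accepts (afterDescent p) f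
  accepts-suc ascended f = refl
  accepts-suc oddRun   f = refl
  accepts-suc evenRun  f = not-involutive (isEven f)

  tₚ·ₚ-suc : ∀ p k → (tₚ ·ₚ p) (suc k) ≡ p k
  tₚ·ₚ-suc p k = begin
    (tₚ ·ₚ p) (suc k)                                  ≡⟨ Σ≤≡∑ (suc k) _ ⟩
    ∑[ i < suc (suc k) ] (tₚ i ℤ.* p (suc k ∸ i))      ≡⟨ ℤ∑.∑-shift (suc k) _ ⟩
    + 0 ℤ.+ ∑[ i < suc k ] (tₚ (suc i) ℤ.* p (k ∸ i))  ≡⟨ ℤ.+-identityˡ _ ⟩
    ∑[ i < suc k ] (tₚ (suc i) ℤ.* p (k ∸ i))          ≡⟨ ℤ∑.∑-shift k _ ⟩
    + 1 ℤ.* p k ℤ.+ ∑[ i < k ] (+ 0 ℤ.* p (k ∸ suc i)) ≡⟨ cong₂ ℤ._+_ (ℤ.*-identityˡ (p k))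
                                                                   (ℤ∑.∑≈0 k (λ _ _ → refl)) ⟩
    p k ℤ.+ + 0                                        ≡⟨ ℤ.+-identityʳ (p k) ⟩
    p k                                                ∎
    where open ≡-Reasoning

  weight-coefficient : ∀ p a l k →
    weight p a l k ≡ indicator ((des (a ∷ l) ℕ.≡ᵇ k) ∧ accepts p (firstAscent (a ∷ l)))
  weight-coefficient ascended a []      zero    = refl
  weight-coefficient ascended a []      (suc k) = refl
  weight-coefficient oddRun   a []      zero    = refl
  weight-coefficient oddRun   a []      (suc k) = refl
  weight-coefficient evenRun  a []      zero    = refl
  weight-coefficient evenRun  a []      (suc k) = refl
  weight-coefficient p        a (b ∷ l) k with b ℕ.<ᵇ a
  ... | true  = descent k
    where
    descent : ∀ k → (tₚ ·ₚ weight (afterDescent p) b l) k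
                  ≡ indicator ((suc (des (b ∷ l)) ℕ.≡ᵇ k) ∧ accepts p (suc (firstAscent (b ∷ l))))
    descent zero    = refl
    descent (suc k) = trans (tₚ·ₚ-suc (weight (afterDescent p) b l) k)
      (trans (weight-coefficient (afterDescent p) b l k)
             (cong (λ x → indicator ((des (b ∷ l) ℕ.≡ᵇ k) ∧ x)) (sym (accepts-suc p (firstAscent (b ∷ l))))))
  ... | false = ascent p
    where
    ascent : ∀ p → (accept p ·ₚ weight ascended b l) k ≡ indicator ((des (b ∷ l) ℕ.≡ᵇ k) ∧ accepts p 1)
    ascent ascended = trans (*-identityˡ (weight ascended b l) k) (weight-coefficient ascended b l k)
    ascent evenRun  = trans (*-identityˡ (weight ascended b l) k) (weight-coefficient ascended b l k)
    ascent oddRun   = trans (zeroˡ (weight ascended b l) k) (cong indicator (sym (∧-zeroʳ _)))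

  permutationWeight-coefficient : ∀ l k →
    permutationWeight l k ≡ indicator (does (isDesarrangement? l) ∧ does (des l ℕ.≟ k))
  permutationWeight-coefficient []      zero    = refl
  permutationWeight-coefficient []      (suc k) = refl
  permutationWeight-coefficient (a ∷ l) k       = trans (weight-coefficient oddRun a l k)
    (cong indicator (trans (∧-comm (des (a ∷ l) ℕ.≡ᵇ k) _)
                           (cong (_∧ (des (a ∷ l) ℕ.≡ᵇ k)) (isEven≡[%2≡ᵇ0] (firstAscent (a ∷ l))))))

  word-coefficient : ∀ l k → (if fresh [] l then permutationWeight l else 0ₚ) k
    ≡ indicator (does (unique? l) ∧ (does (isDesarrangement? l) ∧ does (des l ℕ.≟ k)))
  word-coefficient l k = trans (cong (λ b → (if b then permutationWeight l else 0ₚ) k) (fresh[]≡unique? l))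
                               (restrict (does (unique? l)))
    where
    restrict : ∀ b → (if b then permutationWeight l else 0ₚ) k
                     ≡ indicator (b ∧ (does (isDesarrangement? l) ∧ does (des l ℕ.≟ k)))
    restrict true  = permutationWeight-coefficient l k
    restrict false = refl

  length-filter-∷ : ∀ {A : Set} {P : A → Set} (P? : Decidable P) x xs →
    + length (filter P? (x ∷ xs)) ≡ indicator (does (P? x)) ℤ.+ + length (filter P? xs)
  length-filter-∷ P? x xs with does (P? x)
  ... | true  = refl
  ... | false = refl

  counted≡coefficient : ∀ n k (vs : List (Vec (Fin n) n)) → + length (filter (counted? n k) vs)
    ≡ ∑ₗ vs (λ v → if fresh [] (letters v) then permutationWeight (letters v) else 0ₚ) k
  counted≡coefficient n k []       = refl
  counted≡coefficient n k (v ∷ vs) = trans (length-filter-∷ (counted? n k) v vs)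
    (cong₂ ℤ._+_ (sym (word-coefficient (oneLine v) k)) (counted≡coefficient n k vs))

  Ddes≈desarrangements : ∀ n → Ddes n ≈ₚ desarrangements n
  Ddes≈desarrangements n k = trans (counted≡coefficient n k (words n n)) (desarrangements-counts n k)

module SeriesAsSequences where

  open import Data.Integer as ℤ using (+_)
  open import Data.Integer.Properties using (+-*-commutativeRing)
  open import Relation.Binary.PropositionalEquality
  open PolynomialRing using (polyRing; _≈ₚ_; Σ≤≡∑; ·ₚ-cong; ·ₚ-constantˡ; ×1ₚ≈constant)
  open import Algebra.Properties.Semiring.Exp (CommutativeRing.semiring polyRing) using (_^_)
  open BinomialConvolution polyRing using (_⊛_; constant)
  open IntegerCoefficients polyRing using (fromℕ)
  module ℤ∑ = FiniteSums +-*-commutativeRing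
  open FiniteSums polyRing using (∑)

  ∑-coefficient : ∀ n f j → ∑ n f j ≡ ℤ∑.∑ n (λ k → f k j)
  ∑-coefficient zero    f j = refl
  ∑-coefficient (suc n) f j = cong (ℤ._+ f n j) (∑-coefficient n f j)

  fromℕ-·ₚ : ∀ c p j → (fromℕ c ·ₚ p) j ≡ + c ℤ.* p j
  fromℕ-·ₚ c p j = trans (·ₚ-cong {q = p} (×1ₚ≈constant c) (λ _ → refl) j) (·ₚ-constantˡ (+ c) p j)

  ⋆≈⊛ : ∀ {A A′ B B′} → (∀ k → A k ≈ₚ A′ k) → (∀ k → B k ≈ₚ B′ k) → ∀ n → (A ⋆ B) n ≈ₚ (A′ ⊛ B′) n
  ⋆≈⊛ {A} {A′} {B} {B′} A≈A′ B≈B′ n j = begin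
    Σ≤ n (λ k → + (n C k) ℤ.* (A k ·ₚ B (n ∸ k)) j)                 ≡⟨ Σ≤≡∑ n _ ⟩
    ℤ∑.∑ (suc n) (λ k → + (n C k) ℤ.* (A k ·ₚ B (n ∸ k)) j)         ≡⟨ ℤ∑.∑-cong (suc n) term ⟩
    ℤ∑.∑ (suc n) (λ k → (fromℕ (n C k) ·ₚ (A′ k ·ₚ B′ (n ∸ k))) j) ≡⟨ ∑-coefficient (suc n) _ j ⟨
    (A′ ⊛ B′) n j                                                   ∎
    where
    open ≡-Reasoning
    term : ∀ k → + (n C k) ℤ.* (A k ·ₚ B (n ∸ k)) j ≡ (fromℕ (n C k) ·ₚ (A′ k ·ₚ B′ (n ∸ k))) j
    term k = trans (cong (+ (n C k) ℤ.*_) (·ₚ-cong (A≈A′ k) (B≈B′ (n ∸ k)) j))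
                   (sym (fromℕ-·ₚ (n C k) (A′ k ·ₚ B′ (n ∸ k)) j))

  const≈constant : ∀ p k → const p k ≈ₚ constant p k
  const≈constant p zero    j = refl
  const≈constant p (suc k) j = refl

  expₛ≈^ : ∀ p k → expₛ p k ≈ₚ (p ^ k)
  expₛ≈^ p zero    j = refl
  expₛ≈^ p (suc k) j = ·ₚ-cong {p} (λ _ → refl) (expₛ≈^ p k) j

open PolynomialRing using (polyRing; _≈ₚ_)
open BinomialConvolution polyRing using (_⊛_; constant)
open PhaseWeights polyRing tₚ using (desarrangements)
open ClosedForms polyRing tₚ using (denominator; numerator; desarrangement-egf)
open SeriesAsSequences using (⋆≈⊛; const≈constant; expₛ≈^)
open PermutationCoefficients using (Ddes≈desarrangements)

theorem2p1 : ∀ n j →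
    (const 1-2t ⋆ (expₛ t-1 -ₛ const tₚ) ⋆ Ddes) n j
      ≡ (const 1-t ⋆ (const 1-2t -ₛ expₛ (-ₚ tₚ) +ₛ expₛ t-1)) n j
theorem2p1 n = begin
  (const 1-2t ⋆ (expₛ t-1 -ₛ const tₚ) ⋆ Ddes) n
    ≈⟨ ⋆≈⊛ (⋆≈⊛ (const≈constant 1-2t) denominator≈) Ddes≈desarrangements n ⟩
  ((constant 1-2t ⊛ denominator) ⊛ desarrangements) n
    ≈⟨ desarrangement-egf n ⟩
  (constant 1-t ⊛ numerator) n
    ≈⟨ ⋆≈⊛ (const≈constant 1-t) numerator≈ n ⟨
  (const 1-t ⋆ (const 1-2t -ₛ expₛ (-ₚ tₚ) +ₛ expₛ t-1)) n ∎
  where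
  open import Relation.Binary.Reasoning.Setoid (CommutativeRing.setoid polyRing)
  open import Relation.Binary.PropositionalEquality using (cong₂)
  import Data.Integer as ℤ
  denominator≈ : ∀ k → (expₛ t-1 -ₛ const tₚ) k ≈ₚ denominator k
  denominator≈ k j = cong₂ ℤ._-_ (expₛ≈^ t-1 k j) (const≈constant tₚ k j)
  numerator≈ : ∀ k → (const 1-2t -ₛ expₛ (-ₚ tₚ) +ₛ expₛ t-1) k ≈ₚ numerator k
  numerator≈ k j =
    cong₂ ℤ._+_ (cong₂ ℤ._-_ (const≈constant 1-2t k j) (expₛ≈^ (-ₚ tₚ) k j)) (expₛ≈^ t-1 k j)
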